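{- Set $E^{I}_0(q;x,y)=x$. For every $n\ge1$, $$E^{I}_{n+1}(q;x,y)=y\,E^{I}_n(q;x,y)+\sum_{k=0}^{n-2}q^{\,n-k-1}{n-1\brack k}_q E^{I}_{k+1}(q;x,y)\,E^{I}_{n-k-1}(q;x,y).$$
   Context: An increasing binary tree on $[n]$ is a rooted tree with vertex set $[n]$, root $1$, labels increasing along paths from the root, each vertex having at most one left child and at most one right child. It is an André I tree if for every vertex with at least one child, the maximum label of its left subtree is smaller than that of its right subtree (maximum of the empty tree $:=0$). $l(T)$ is the number of leaves, $u(T)$ the number of vertices with exactly one child, and $\mathrm{inv}(T)$ the number of pairs $(i,j)$, $i>j$, such that either (1) $j$ is not on the path from $1$ to $i$ and some vertex $v$ on that path has $i$ in its left subtree and $j$ in its right subtree, or (2) $j$ is on the path from $1$ to $i$ and the left child of $j$ is on this path. For $n\ge1$, $E^{I}_n(q;x,y)=\sum_T x^{l(T)}y^{u(T)}q^{\mathrm{inv}(T)}$ over André I trees on $[n]$. ${m\brack k}_q=\frac{(q;q)_m}{(q;q)_k(q;q)_{m-k}}$ with $(q;q)_m=\prod_{j=1}^m(1-q^j)$. -}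

module Defs where

open import Level using (Level)
open import Data.Nat using (ℕ; zero; suc; _+_; _∸_; _<ᵇ_; _≡ᵇ_)
open import Data.Bool using (Bool; true; false; _∧_; _∨_; not; if_then_else_)
open import Data.List using (List; []; _∷_; map; concatMap; foldr; filter; length; upTo; _++_)
open import Data.Bool.ListAction using (any; all)
open import Data.Maybe using (Maybe; just; nothing)
open import Relation.Nullary.Decidable using (Dec; yes; no)
open import Data.Bool using (T)
open import Data.Bool.Properties using (T?)
open import Algebra.Bundles using (CommutativeRing)

-- Labelled binary trees: `lf` is the empty tree, `nd v l r` is a vertex
-- labelled v with left subtree l and right subtree r.

data BT : Set where
  lf : BT
  nd : ℕ → BT → BT → BT

range : ℕ → List ℕ
range n = map suc (upTo n)

labels : BT → List ℕ
labels lf = []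
labels (nd v l r) = v ∷ labels l ++ labels r

memL : ℕ → List ℕ → Bool
memL i xs = any (λ v → v ≡ᵇ i) xs

count : ℕ → List ℕ → ℕ
count i [] = 0
count i (x ∷ xs) = (if x ≡ᵇ i then 1 else 0) + count i xs

mem : ℕ → BT → Bool
mem i t = memL i (labels t)

treesH : ℕ → ℕ → List BT
treesH n zero = lf ∷ []
treesH n (suc h) =
  lf ∷ concatMap (λ v → concatMap (λ l → map (λ r → nd v l r) (treesH n h)) (treesH n h)) (range n)

maxL : List ℕ → ℕ
maxL [] = 0
maxL (x ∷ xs) with x <ᵇ maxL xs
... | true = maxL xs
... | false = x

rootIs : ℕ → BT → Bool
rootIs i lf = false
rootIs i (nd v _ _) = v ≡ᵇ i

increasing : BT → Bool
increasing lf = true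
increasing (nd v l r) = childOK l ∧ childOK r ∧ increasing l ∧ increasing r
  where
  childOK : BT → Bool
  childOK lf = true
  childOK (nd w _ _) = v <ᵇ w

-- André I condition at every vertex having at least one child:
-- max label of left subtree < max label of right subtree (max ∅ = 0)
andreCond : BT → Bool
andreCond lf = true
andreCond (nd v lf lf) = true
andreCond (nd v l r) = (maxL (labels l) <ᵇ maxL (labels r)) ∧ andreCond l ∧ andreCond r

vertexSet : ℕ → BT → Bool
vertexSet n t = (length (labels t) ≡ᵇ n) ∧ all (λ i → count i (labels t) ≡ᵇ 1) (range n)

isAndreI : ℕ → BT → Bool
isAndreI n t = vertexSet n t ∧ rootIs 1 t ∧ increasing t ∧ andreCond t

-- the André I trees on [n] (height of a tree on n vertices is ≤ n)
andreI : ℕ → List BT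
andreI n = filter (λ t → T? (isAndreI n t)) (treesH n n)

leaves : BT → ℕ
leaves lf = 0
leaves (nd _ lf lf) = 1
leaves (nd _ l r) = leaves l + leaves r

isNd : BT → Bool
isNd lf = false
isNd (nd _ _ _) = true

oneChild : BT → ℕ
oneChild lf = 0
oneChild (nd _ l r) = (if isNd l ∧ not (isNd r) ∨ not (isNd l) ∧ isNd r then 1 else 0) + oneChild l + oneChild r

-- subtree rooted at vertex v (lf if v absent)
subAt : ℕ → BT → BT
subAt v lf = lf
subAt v (nd w l r) with w ≡ᵇ v
... | true = nd w l r
... | false with mem v l
...   | true = subAt v l
...   | false = subAt v r

leftSub rightSub : ℕ → BT → BT
leftSub v t with subAt v t
... | nd _ l _ = l
... | lf = lf
rightSub v t with subAt v t
... | nd _ _ r = r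
... | lf = lf

leftChild : ℕ → BT → Maybe ℕ
leftChild v t with leftSub v t
... | nd w _ _ = just w
... | lf = nothing

-- labels on the path from the root to i (inclusive); [] if i absent
path : ℕ → BT → List ℕ
path i lf = []
path i (nd v l r) with v ≡ᵇ i
... | true = v ∷ []
... | false with mem i l
...   | true = v ∷ path i l
...   | false with mem i r
...     | true = v ∷ path i r
...     | false = []

invPair : BT → ℕ → ℕ → Bool
invPair t i j with memL j (path i t)
... | false = any (λ v → mem i (leftSub v t) ∧ mem j (rightSub v t)) (path i t)
... | true with leftChild j t
...   | nothing = false
...   | just c = memL c (path i t)

inv : ℕ → BT → ℕ
inv n t = length (concatMap (λ i → filter (λ j → T? ((j <ᵇ i) ∧ invPair t i j)) (range n)) (range n))

module _ {c ℓ : Level} (R : CommutativeRing c ℓ) where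
  open CommutativeRing R using (Carrier; _*_; 1#; 0#) renaming (_+_ to _+R_)

  pow : Carrier → ℕ → Carrier
  pow a zero = 1#
  pow a (suc k) = a * pow a k

  ΣR : List Carrier → Carrier
  ΣR = foldr _+R_ 0#

  EI : Carrier → Carrier → Carrier → ℕ → Carrier
  EI q x y zero = x
  EI q x y n@(suc _) =
    ΣR (map (λ t → pow x (leaves t) * pow y (oneChild t) * pow q (inv n t)) (andreI n))

  qbinom : Carrier → ℕ → ℕ → Carrier
  qbinom q m zero = 1#
  qbinom q zero (suc k) = 0#
  qbinom q (suc m) (suc k) = qbinom q m k +R pow q (suc k) * qbinom q m (suc k)

-- An André I tree on a sorted label list S with minimum s is the root s together with André I
-- trees on the two parts (A , B) of a split of the other labels, where max S ∈ B; each such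
-- triple occurs exactly once.  Along this decomposition the leaves add up, the root has one
-- child iff A is empty (a factor y), and the inversions are those of the subtrees, the |A| pairs
-- (i ∈ A , s) of condition (2), and the pairs i ∈ A, j ∈ B with j < i of condition (1) at the root.
-- Hence the weight sum only depends on |S|, and summing q^#{j < i} over the splits with
-- |B| = k + 1 produces the Gaussian binomial [n−1 k]_q (q-Pascal).  The term k = n − 1 (A empty)
-- is y E_n, the others are q^(n−k−1) [n−1 k]_q E_(k+1) E_(n−k−1).

module Submission where

open import Defs
open import Level using (Level)
open import Algebra.Bundles using (CommutativeRing)
open import Data.Nat using (ℕ; suc; _∸_; _≤_; s≤s; z≤n)
open import Data.List using (map; upTo)

module Trees where

  open import Function using (_∘_; id)
  open import Function.Bundles using (Equivalence; mk⇔)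
  open import Data.Empty using (⊥-elim)
  open import Data.Unit using (⊤; tt)
  open import Data.Product using (∃; ∃₂; _×_; _,_; proj₁; proj₂; map₁)
  open import Data.Sum using (_⊎_; inj₁; inj₂)
  open import Data.Maybe using (Maybe; just; nothing)
  open import Data.Bool using (Bool; true; false; _∧_; _∨_; if_then_else_; T)
  open import Data.Bool.ListAction using (any; all)
  open import Data.Bool.Properties using (T-∧; T-≡; T?; ∧-zeroʳ; ∨-zeroʳ; ∧-identityʳ)
  open import Data.Nat using (ℕ; zero; suc; _+_; _≤_; _<_; z≤n; s≤s; z<s; _<ᵇ_; _≡ᵇ_; _⊔_)
  open import Data.Nat.Properties
  open import Algebra.Properties.CommutativeSemigroup +-commutativeSemigroup using (interchange; x∙yz≈y∙xz)
  open import Data.List using (List; []; _∷_; map; concat; concatMap; filter; length; upTo; applyUpTo; _++_; cartesianProductWith)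
  open import Data.List.Properties
    using (length-++; length-map; length-applyUpTo; ++-conicalˡ; ++-conicalʳ; map-cong)
  open import Data.List.Membership.Propositional using (_∈_; _∉_; find; lose)
  open import Data.List.Membership.Propositional.Properties
    using (∈-map⁺; ∈-map⁻; ∈-++⁺ˡ; ∈-++⁺ʳ; ∈-++⁻; ∈-concatMap⁺; ∈-concatMap⁻; ∈-filter⁺; ∈-filter⁻;
           ∈-cartesianProductWith⁺; ∈-cartesianProductWith⁻)
  open import Data.List.Membership.Propositional.Properties.WithK using (unique∧set⇒bag)
  open import Data.List.Membership.DecPropositional _≟_ using (_∈?_)
  open import Data.List.Relation.Unary.Any using (here; there)
  open import Data.List.Relation.Unary.All as All using (All; []; _∷_)
  import Data.List.Relation.Unary.All.Properties as All
  open import Data.List.Relation.Unary.AllPairs as AllPairs using (AllPairs; []; _∷_)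
  import Data.List.Relation.Unary.AllPairs.Properties as AllPairs
  open import Data.List.Relation.Unary.Unique.Propositional using (Unique)
  import Data.List.Relation.Unary.Unique.Propositional.Properties as Unique
  open import Data.List.Relation.Binary.Subset.Propositional.Properties using (All-resp-⊇; ∷⁺ʳ)
  open import Data.List.Relation.Binary.BagAndSetEquality using (∼bag⇒↭)
  open import Data.List.Relation.Binary.Permutation.Propositional using (_↭_; ↭-refl; ↭-sym; ↭-trans; prep; ↭⇒↭ₛ)
  import Data.List.Relation.Binary.Permutation.Propositional as ↭
  open import Data.List.Relation.Binary.Permutation.Propositional.Properties
    using (∈-resp-↭; ↭-length; drop-∷; shift; ¬x∷xs↭[]; ↭-empty-inv)
    renaming (++⁺ to ↭-++⁺)
  import Data.List.Relation.Binary.Permutation.Setoid.Properties as ↭ₛ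
  open import Relation.Nullary using (¬_; Dec; yes; no; ¬?)
  open import Relation.Binary.PropositionalEquality using (_≡_; _≢_; refl; sym; trans; cong; cong₂; subst; module ≡-Reasoning)
  import Relation.Binary.PropositionalEquality as ≡
  open import Data.Nat.Solver using (module +-*-Solver)

  ∈-concatMap-find : ∀ {A B : Set} {g : A → List B} {xs : List A} {y} → y ∈ concatMap g xs → ∃ λ x → x ∈ xs × y ∈ g x
  ∈-concatMap-find {g = g} {xs} y∈ = find (∈-concatMap⁻ g {xs = xs} y∈)

  ∈-concatMap-lose : ∀ {A B : Set} {g : A → List B} {xs : List A} {x y} → x ∈ xs → y ∈ g x → y ∈ concatMap g xs
  ∈-concatMap-lose {g = g} x∈ y∈ = ∈-concatMap⁺ g (lose x∈ y∈)

  Unique-concatMap : ∀ {A B : Set} (g : A → List B) {xs : List A} → Unique xs →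
    (∀ {a} → a ∈ xs → Unique (g a)) →
    (∀ {a a′ y} → a ∈ xs → a′ ∈ xs → y ∈ g a → y ∈ g a′ → a ≡ a′) → Unique (concatMap g xs)
  Unique-concatMap g {[]} _ _ _ = []
  Unique-concatMap g {a ∷ xs} (a∉xs ∷ u) ug dj =
    Unique.++⁺ (ug (here refl)) (Unique-concatMap g u (ug ∘ there) (λ m m′ → dj (there m) (there m′))) disjoint
    where
    disjoint : ∀ {y} → ¬ (y ∈ g a × y ∈ concatMap g xs)
    disjoint (y∈ga , y∈rest) with ∈-concatMap-find {g = g} {xs} y∈rest
    ... | a′ , a′∈xs , y∈ga′ = All.lookup a∉xs a′∈xs (dj (here refl) (there a′∈xs) y∈ga y∈ga′)

  Unique-resp-↭ : ∀ {A : Set} {xs ys : List A} → xs ↭ ys → Unique xs → Unique ys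
  Unique-resp-↭ {A} p = ↭ₛ.Unique-resp-↭ (≡.setoid A) (↭⇒↭ₛ p)

  Unique-++⁻ : ∀ {A : Set} (xs : List A) {ys} → Unique (xs ++ ys) → Unique xs × Unique ys × (∀ {x} → x ∈ xs → x ∉ ys)
  Unique-++⁻ [] u = [] , u , λ ()
  Unique-++⁻ (a ∷ xs) (a∉ ∷ u) with Unique-++⁻ xs u
  ... | uxs , uys , dj = (All.++⁻ˡ xs a∉ ∷ uxs) , uys , disjoint
    where
    disjoint : ∀ {x} → x ∈ a ∷ xs → x ∉ _
    disjoint (here refl) x∈ys = All.lookup (All.++⁻ʳ xs a∉) x∈ys refl
    disjoint (there x∈xs) = dj x∈xs

  ↭-from-⊆⊇ : ∀ {A : Set} {xs ys : List A} → Unique xs → Unique ys →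
    (∀ {x} → x ∈ xs → x ∈ ys) → (∀ {x} → x ∈ ys → x ∈ xs) → xs ↭ ys
  ↭-from-⊆⊇ ux uy ⊆ ⊇ = ∼bag⇒↭ (unique∧set⇒bag ux uy (mk⇔ ⊆ ⊇))

  Sorted : List ℕ → Set
  Sorted = AllPairs _<_

  Sorted⇒Unique : ∀ {xs} → Sorted xs → Unique xs
  Sorted⇒Unique = AllPairs.map <⇒≢

  Sorted-↭⇒≡ : ∀ {xs ys} → Sorted xs → Sorted ys → xs ↭ ys → xs ≡ ys
  Sorted-↭⇒≡ {[]} {[]} _ _ _ = refl
  Sorted-↭⇒≡ {[]} {_ ∷ _} _ _ p = ⊥-elim (¬x∷xs↭[] (↭-sym p))
  Sorted-↭⇒≡ {_ ∷ _} {[]} _ _ p = ⊥-elim (¬x∷xs↭[] p)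
  Sorted-↭⇒≡ {x ∷ xs} {y ∷ ys} (x< ∷ sx) (y< ∷ sy) p with ∈-resp-↭ p (here refl) | ∈-resp-↭ (↭-sym p) (here refl)
  ... | here refl | _ = cong (x ∷_) (Sorted-↭⇒≡ sx sy (drop-∷ p))
  ... | there x∈ys | here y≡x = ⊥-elim (<-irrefl y≡x (All.lookup y< x∈ys))
  ... | there x∈ys | there y∈xs = ⊥-elim (<-asym (All.lookup y< x∈ys) (All.lookup x< y∈xs))

  Split : Set
  Split = List ℕ × List ℕ

  addˡ addʳ : ℕ → Split → Split
  addˡ a (A , B) = a ∷ A , B
  addʳ a (A , B) = A , a ∷ B

  -- The last element always goes to the right part: for a sorted list this is where
  -- the André condition (max left < max right) puts the maximum.
  splits : ℕ → List ℕ → List Split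
  splits b [] = ([] , b ∷ []) ∷ []
  splits b (c ∷ xs) = map (addˡ b) (splits c xs) ++ map (addʳ b) (splits c xs)

  lastOf : ℕ → List ℕ → ℕ
  lastOf b [] = b
  lastOf b (c ∷ xs) = lastOf c xs

  ∈-splits⁻ : ∀ b c xs {p} → p ∈ splits b (c ∷ xs) →
    ∃ λ p′ → p′ ∈ splits c xs × (p ≡ addˡ b p′ ⊎ p ≡ addʳ b p′)
  ∈-splits⁻ b c xs p∈ with ∈-++⁻ (map (addˡ b) (splits c xs)) p∈
  ... | inj₁ p∈ˡ with ∈-map⁻ (addˡ b) p∈ˡ
  ...   | p′ , p′∈ , refl = p′ , p′∈ , inj₁ refl
  ∈-splits⁻ b c xs p∈ | inj₂ p∈ʳ with ∈-map⁻ (addʳ b) p∈ʳ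
  ...   | p′ , p′∈ , refl = p′ , p′∈ , inj₂ refl

  splits-↭ : ∀ b xs {A B} → (A , B) ∈ splits b xs → A ++ B ↭ b ∷ xs
  splits-↭ b [] (here refl) = ↭-refl
  splits-↭ b (c ∷ xs) p∈ with ∈-splits⁻ b c xs p∈
  ... | (A , B) , p′∈ , inj₁ refl = prep b (splits-↭ c xs p′∈)
  ... | (A , B) , p′∈ , inj₂ refl = ↭-trans (shift b A B) (prep b (splits-↭ c xs p′∈))

  splits-length : ∀ b xs {A B} → (A , B) ∈ splits b xs → length A + length B ≡ suc (length xs)
  splits-length b xs {A} p∈ = trans (sym (length-++ A)) (↭-length (splits-↭ b xs p∈))

  splits-⊆ˡ : ∀ b xs {A B x} → (A , B) ∈ splits b xs → x ∈ A → x ∈ b ∷ xs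
  splits-⊆ˡ b xs p∈ x∈ = ∈-resp-↭ (splits-↭ b xs p∈) (∈-++⁺ˡ x∈)

  splits-⊆ʳ : ∀ b xs {A B x} → (A , B) ∈ splits b xs → x ∈ B → x ∈ b ∷ xs
  splits-⊆ʳ b xs {A} p∈ x∈ = ∈-resp-↭ (splits-↭ b xs p∈) (∈-++⁺ʳ A x∈)

  splits-AllPairs : ∀ {R : ℕ → ℕ → Set} b xs {A B} → (A , B) ∈ splits b xs →
    AllPairs R (b ∷ xs) → AllPairs R A × AllPairs R B
  splits-AllPairs b [] (here refl) _ = [] , [] ∷ []
  splits-AllPairs b (c ∷ xs) p∈ (b-R ∷ R-cxs) with ∈-splits⁻ b c xs p∈
  ... | (A , B) , p′∈ , inj₁ refl =
    (All-resp-⊇ (splits-⊆ˡ c xs p′∈) b-R ∷ proj₁ (splits-AllPairs c xs p′∈ R-cxs)) , proj₂ (splits-AllPairs c xs p′∈ R-cxs)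
  ... | (A , B) , p′∈ , inj₂ refl =
    proj₁ (splits-AllPairs c xs p′∈ R-cxs) , (All-resp-⊇ (splits-⊆ʳ c xs p′∈) b-R ∷ proj₂ (splits-AllPairs c xs p′∈ R-cxs))

  lastOf-∈ : ∀ b xs → lastOf b xs ∈ b ∷ xs
  lastOf-∈ b [] = here refl
  lastOf-∈ b (c ∷ xs) = there (lastOf-∈ c xs)

  lastOf-max : ∀ b xs {x} → Sorted (b ∷ xs) → x ∈ b ∷ xs → x ≤ lastOf b xs
  lastOf-max b [] _ (here refl) = ≤-refl
  lastOf-max b (c ∷ xs) (b< ∷ _) (here refl) = <⇒≤ (All.lookup b< (lastOf-∈ c xs))
  lastOf-max b (c ∷ xs) (_ ∷ s) (there x∈) = lastOf-max c xs s x∈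

  splits-lastOf∈ʳ : ∀ b xs {A B} → (A , B) ∈ splits b xs → lastOf b xs ∈ B
  splits-lastOf∈ʳ b [] (here refl) = here refl
  splits-lastOf∈ʳ b (c ∷ xs) p∈ with ∈-splits⁻ b c xs p∈
  ... | _ , p′∈ , inj₁ refl = splits-lastOf∈ʳ c xs p′∈
  ... | _ , p′∈ , inj₂ refl = there (splits-lastOf∈ʳ c xs p′∈)

  splits-<lastOf : ∀ b xs {A B} → Sorted (b ∷ xs) → (A , B) ∈ splits b xs → All (_< lastOf b xs) A
  splits-<lastOf b [] _ (here refl) = []
  splits-<lastOf b (c ∷ xs) (b< ∷ s) p∈ with ∈-splits⁻ b c xs p∈
  ... | _ , p′∈ , inj₁ refl = All.lookup b< (lastOf-∈ c xs) ∷ splits-<lastOf c xs s p′∈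
  ... | _ , p′∈ , inj₂ refl = splits-<lastOf c xs s p′∈

  filter-∈-splits : ∀ b xs {P : ℕ → Set} (P? : ∀ x → Dec (P x)) → ¬ P (lastOf b xs) →
    (filter P? (b ∷ xs) , filter (¬? ∘ P?) (b ∷ xs)) ∈ splits b xs
  filter-∈-splits b [] P? ¬P with P? b
  ... | yes Pb = ⊥-elim (¬P Pb)
  ... | no _ = here refl
  filter-∈-splits b (c ∷ xs) P? ¬P with P? b
  ... | yes _ = ∈-++⁺ˡ (∈-map⁺ (addˡ b) (filter-∈-splits c xs P? ¬P))
  ... | no _ = ∈-++⁺ʳ (map (addˡ b) (splits c xs)) (∈-map⁺ (addʳ b) (filter-∈-splits c xs P? ¬P))

  splits-unique : ∀ b xs → Unique (b ∷ xs) → Unique (splits b xs)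
  splits-unique b [] _ = [] ∷ []
  splits-unique b (c ∷ xs) (b∉ ∷ u) =
    Unique.++⁺ (Unique.map⁺ addˡ-injective (splits-unique c xs u)) (Unique.map⁺ addʳ-injective (splits-unique c xs u)) disjoint
    where
    addˡ-injective : ∀ {p p′} → addˡ b p ≡ addˡ b p′ → p ≡ p′
    addˡ-injective {_ , _} {_ , _} refl = refl
    addʳ-injective : ∀ {p p′} → addʳ b p ≡ addʳ b p′ → p ≡ p′
    addʳ-injective {_ , _} {_ , _} refl = refl
    disjoint : ∀ {p} → ¬ (p ∈ map (addˡ b) (splits c xs) × p ∈ map (addʳ b) (splits c xs))
    disjoint (p∈ˡ , p∈ʳ) with ∈-map⁻ (addˡ b) p∈ˡ | ∈-map⁻ (addʳ b) p∈ʳ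
    ... | (A , B) , _ , refl | (A′ , B′) , p′∈ , e =
      All.lookup b∉ (splits-⊆ˡ c xs p′∈ (subst (b ∈_) (cong proj₁ e) (here refl))) refl

  T-∧⁻ : ∀ {a b} → T (a ∧ b) → T a × T b
  T-∧⁻ = Equivalence.to T-∧

  T-∧³⁻ : ∀ {a b c} → T (a ∧ b ∧ c) → T a × T b × T c
  T-∧³⁻ {a} h = proj₁ (T-∧⁻ {a} h) , T-∧⁻ (proj₂ (T-∧⁻ {a} h))

  T-∧⁺ : ∀ {a b} → T a → T b → T (a ∧ b)
  T-∧⁺ ta tb = Equivalence.from T-∧ (ta , tb)

  T⇒≡true : ∀ {b} → T b → b ≡ true
  T⇒≡true = Equivalence.to T-≡

  ¬T⇒≡false : ∀ {b} → ¬ T b → b ≡ false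
  ¬T⇒≡false {false} _ = refl
  ¬T⇒≡false {true} ¬t = ⊥-elim (¬t tt)

  ≡ᵇ-true : ∀ a → (a ≡ᵇ a) ≡ true
  ≡ᵇ-true a = T⇒≡true (≡⇒≡ᵇ a a refl)

  ≡ᵇ-false : ∀ a b → a ≢ b → (a ≡ᵇ b) ≡ false
  ≡ᵇ-false a b a≢b = ¬T⇒≡false (a≢b ∘ ≡ᵇ⇒≡ a b)

  <ᵇ-true : ∀ a b → a < b → (a <ᵇ b) ≡ true
  <ᵇ-true a b = T⇒≡true ∘ <⇒<ᵇ

  <ᵇ-false : ∀ a b → ¬ a < b → (a <ᵇ b) ≡ false
  <ᵇ-false a b a≮b = ¬T⇒≡false (a≮b ∘ <ᵇ⇒< a b)

  _<root_ : ℕ → BT → Set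
  v <root lf = ⊤
  v <root nd w _ _ = v < w

  <root-labels : ∀ {v} t → All (v <_) (labels t) → v <root t
  <root-labels lf _ = tt
  <root-labels (nd w _ _) (v<w ∷ _) = v<w

  childAbove : ℕ → BT → Bool
  childAbove v lf = true
  childAbove v (nd w _ _) = v <ᵇ w

  increasing-nd : ∀ v l r → increasing (nd v l r) ≡ childAbove v l ∧ childAbove v r ∧ increasing l ∧ increasing r
  increasing-nd v lf lf = refl
  increasing-nd v lf (nd _ _ _) = refl
  increasing-nd v (nd _ _ _) lf = refl
  increasing-nd v (nd _ _ _) (nd _ _ _) = refl

  childAbove⇔<root : ∀ v t → (T (childAbove v t) → v <root t) × (v <root t → T (childAbove v t))
  childAbove⇔<root v lf = (λ _ → tt) , (λ _ → tt)
  childAbove⇔<root v (nd w _ _) = <ᵇ⇒< v w , <⇒<ᵇ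

  increasing-nd⁻ : ∀ v l r → T (increasing (nd v l r)) →
    v <root l × v <root r × T (increasing l) × T (increasing r)
  increasing-nd⁻ v l r h with T-∧⁻ (subst T (increasing-nd v l r) h)
  ... | al , h′ with T-∧⁻ h′
  ...   | ar , h″ with T-∧⁻ h″
  ...     | il , ir = proj₁ (childAbove⇔<root v l) al , proj₁ (childAbove⇔<root v r) ar , il , ir

  increasing-nd⁺ : ∀ v l r → v <root l → v <root r → T (increasing l) → T (increasing r) →
    T (increasing (nd v l r))
  increasing-nd⁺ v l r al ar il ir = subst T (sym (increasing-nd v l r))
    (T-∧⁺ (proj₂ (childAbove⇔<root v l) al) (T-∧⁺ (proj₂ (childAbove⇔<root v r) ar) (T-∧⁺ il ir)))

  increasing⇒root<labels : ∀ v l r → T (increasing (nd v l r)) → All (v <_) (labels l ++ labels r)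
  increasing⇒root<labels v l r h with increasing-nd⁻ v l r h
  ... | al , ar , il , ir = All.++⁺ (below l al il) (below r ar ir)
    where
    below : ∀ s → v <root s → T (increasing s) → All (v <_) (labels s)
    below lf _ _ = []
    below (nd w a b) v<w is = v<w ∷ All.map (<-trans v<w) (increasing⇒root<labels w a b is)

  -- The label x only excludes l = r = lf, where andreCond holds without any comparison.
  andreCond-nd⁻ : ∀ v l r {x} → x ∈ labels l ++ labels r → T (andreCond (nd v l r)) →
    maxL (labels l) < maxL (labels r) × T (andreCond l) × T (andreCond r)
  andreCond-nd⁻ v l r x∈ h = map₁ (<ᵇ⇒< _ _) (conditions l r x∈ h)
    where
    conditions : ∀ l r {x} → x ∈ labels l ++ labels r → T (andreCond (nd v l r)) →
      T (maxL (labels l) <ᵇ maxL (labels r)) × T (andreCond l) × T (andreCond r)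
    conditions lf (nd _ _ _) _ h = T-∧³⁻ h
    conditions (nd _ _ _) lf _ h = T-∧³⁻ h
    conditions (nd _ _ _) (nd _ _ _) _ h = T-∧³⁻ h

  andreCond-nd⁺ : ∀ v l r → maxL (labels l) < maxL (labels r) → T (andreCond l) → T (andreCond r) →
    T (andreCond (nd v l r))
  andreCond-nd⁺ v lf lf _ _ _ = tt
  andreCond-nd⁺ v lf (nd _ _ _) lt al ar = T-∧⁺ (<⇒<ᵇ lt) (T-∧⁺ al ar)
  andreCond-nd⁺ v (nd _ _ _) lf lt al ar = T-∧⁺ (<⇒<ᵇ lt) (T-∧⁺ al ar)
  andreCond-nd⁺ v (nd _ _ _) (nd _ _ _) lt al ar = T-∧⁺ (<⇒<ᵇ lt) (T-∧⁺ al ar)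

  maxL-upper : ∀ {x} xs → x ∈ xs → x ≤ maxL xs
  maxL-upper (y ∷ ys) x∈ with y <ᵇ maxL ys in eq
  maxL-upper (y ∷ ys) (here refl) | true = <⇒≤ (<ᵇ⇒< y (maxL ys) (subst T (sym eq) tt))
  maxL-upper (y ∷ ys) (there x∈) | true = maxL-upper ys x∈
  maxL-upper (y ∷ ys) (here refl) | false = ≤-refl
  maxL-upper (y ∷ ys) (there x∈) | false = ≤-trans (maxL-upper ys x∈) (≮⇒≥ (λ lt → subst T eq (<⇒<ᵇ lt)))

  maxL-least : ∀ {b} xs → All (_≤ b) xs → maxL xs ≤ b
  maxL-least [] _ = z≤n
  maxL-least (y ∷ ys) (y≤ ∷ ys≤) with y <ᵇ maxL ys
  ... | true = maxL-least ys ys≤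
  ... | false = y≤

  -- The bound must be positive since maxL [] = 0.
  maxL-< : ∀ {b} xs → 0 < b → All (_< b) xs → maxL xs < b
  maxL-< [] 0<b _ = 0<b
  maxL-< (y ∷ ys) 0<b (y< ∷ ys<) with y <ᵇ maxL ys
  ... | true = maxL-< ys 0<b ys<
  ... | false = y<

  -- Enumerating the André trees on a sorted label list

  AndreOn : List ℕ → BT → Set
  AndreOn S t = labels t ↭ S × T (increasing t) × T (andreCond t)

  nodes : ℕ → List BT → List BT → List BT
  nodes s = cartesianProductWith (nd s)

  -- Recursion into the parts of a split is not structural, hence the fuel f; it bounds the
  -- height of the trees and is sufficient once length S ≤ f.
  andreTrees : ℕ → List ℕ → List BT
  andreTrees _ [] = lf ∷ []
  andreTrees zero (_ ∷ _) = []
  andreTrees (suc f) (s ∷ []) = nd s lf lf ∷ []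
  andreTrees (suc f) (s ∷ b ∷ xs) =
    concatMap (λ p → nodes s (andreTrees f (proj₁ p)) (andreTrees f (proj₂ p))) (splits b xs)

  ∈-andreTrees⁻ : ∀ f s b xs {t} → t ∈ andreTrees (suc f) (s ∷ b ∷ xs) →
    ∃₂ λ A B → (A , B) ∈ splits b xs × ∃₂ λ l r → l ∈ andreTrees f A × r ∈ andreTrees f B × t ≡ nd s l r
  ∈-andreTrees⁻ f s b xs t∈
    with ∈-concatMap-find {g = λ p → nodes s (andreTrees f (proj₁ p)) (andreTrees f (proj₂ p))} {splits b xs} t∈
  ... | (A , B) , p∈ , t∈′ with ∈-cartesianProductWith⁻ (nd s) (andreTrees f A) (andreTrees f B) t∈′
  ...   | l , r , l∈ , r∈ , t≡ = A , B , p∈ , l , r , l∈ , r∈ , t≡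

  ∈-andreTrees⁺ : ∀ f s b xs {A B l r} → (A , B) ∈ splits b xs → l ∈ andreTrees f A → r ∈ andreTrees f B →
    nd s l r ∈ andreTrees (suc f) (s ∷ b ∷ xs)
  ∈-andreTrees⁺ f s b xs p∈ l∈ r∈ = ∈-concatMap-lose p∈ (∈-cartesianProductWith⁺ (nd s) l∈ r∈)

  andreTrees-root : ∀ f s S {t} → t ∈ andreTrees f (s ∷ S) → ∃₂ λ l r → t ≡ nd s l r
  andreTrees-root (suc f) s [] (here refl) = lf , lf , refl
  andreTrees-root (suc f) s (b ∷ xs) t∈ with ∈-andreTrees⁻ f s b xs t∈
  ... | _ , _ , _ , l , r , _ , _ , t≡ = l , r , t≡

  andreTrees-nd : ∀ f {S z t} → z ∈ S → t ∈ andreTrees f S → ∃ λ v → ∃₂ λ a b → t ≡ nd v a b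
  andreTrees-nd f {s ∷ S} _ t∈ with andreTrees-root f s S t∈
  ... | a , b , t≡ = s , a , b , t≡

  height : BT → ℕ
  height lf = 0
  height (nd _ l r) = suc (height l ⊔ height r)

  andreTrees-height : ∀ f S {t} → t ∈ andreTrees f S → height t ≤ f
  andreTrees-height f [] (here refl) = z≤n
  andreTrees-height (suc f) (s ∷ []) (here refl) = s≤s z≤n
  andreTrees-height (suc f) (s ∷ b ∷ xs) t∈ with ∈-andreTrees⁻ f s b xs t∈
  ... | A , B , _ , l , r , l∈ , r∈ , refl = s≤s (⊔-lub (andreTrees-height f A l∈) (andreTrees-height f B r∈))

  andreTrees-sound : ∀ f S {t} → Sorted S → t ∈ andreTrees f S → AndreOn S t
  andreTrees-sound f [] _ (here refl) = ↭-refl , tt , tt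
  andreTrees-sound (suc f) (s ∷ []) _ (here refl) = ↭-refl , tt , tt
  andreTrees-sound (suc f) (s ∷ b ∷ xs) (s< ∷ sorted) t∈ with ∈-andreTrees⁻ f s b xs t∈
  ... | A , B , p∈ , l , r , l∈ , r∈ , refl
    with andreTrees-sound f A (proj₁ (splits-AllPairs b xs p∈ sorted)) l∈
       | andreTrees-sound f B (proj₂ (splits-AllPairs b xs p∈ sorted)) r∈
  ... | l↭A , incl , andl | r↭B , incr , andr =
    prep s (↭-trans (↭-++⁺ l↭A r↭B) (splits-↭ b xs p∈)) ,
    increasing-nd⁺ s l r (s<root l l↭A (splits-⊆ˡ b xs p∈)) (s<root r r↭B (splits-⊆ʳ b xs p∈)) incl incr ,
    andreCond-nd⁺ s l r maxl<maxr andl andr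
    where
    s<root : ∀ u {X} → labels u ↭ X → (∀ {x} → x ∈ X → x ∈ b ∷ xs) → s <root u
    s<root u u↭X X⊆ = <root-labels u (All.tabulate (λ x∈ → All.lookup s< (X⊆ (∈-resp-↭ u↭X x∈))))
    maxl<maxr : maxL (labels l) < maxL (labels r)
    maxl<maxr = <-≤-trans
      (maxL-< (labels l) (<-≤-trans z<s (All.lookup s< (lastOf-∈ b xs)))
        (All-resp-⊇ (∈-resp-↭ l↭A) (splits-<lastOf b xs sorted p∈)))
      (maxL-upper (labels r) (∈-resp-↭ (↭-sym r↭B) (splits-lastOf∈ʳ b xs p∈)))

  ↭-splits : ∀ b xs {L R : List ℕ} → Sorted (b ∷ xs) → L ++ R ↭ b ∷ xs → lastOf b xs ∉ L →
    ∃₂ λ A B → (A , B) ∈ splits b xs × L ↭ A × R ↭ B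
  ↭-splits b xs {L} {R} sorted LR↭ last∉L =
    filter inL? S , filter notInL? S , filter-∈-splits b xs inL? last∉L , L↭A , R↭B
    where
    S = b ∷ xs
    inL? = _∈? L
    notInL? = ¬? ∘ inL?
    uniqueS = Sorted⇒Unique sorted
    disjoint = Unique-++⁻ L (Unique-resp-↭ (↭-sym LR↭) uniqueS)
    toS : ∀ {x} → x ∈ L ++ R → x ∈ S
    toS = ∈-resp-↭ LR↭
    fromS : ∀ {x} → x ∈ S → x ∈ L ++ R
    fromS = ∈-resp-↭ (↭-sym LR↭)
    L↭A : L ↭ filter inL? S
    L↭A = ↭-from-⊆⊇ (proj₁ disjoint) (Unique.filter⁺ inL? uniqueS)
      (λ x∈ → ∈-filter⁺ inL? (toS (∈-++⁺ˡ x∈)) x∈) (proj₂ ∘ ∈-filter⁻ inL?)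
    inR : ∀ {x} → x ∈ S × x ∉ L → x ∈ R
    inR (x∈S , x∉L) with ∈-++⁻ L (fromS x∈S)
    ... | inj₁ x∈L = ⊥-elim (x∉L x∈L)
    ... | inj₂ x∈R = x∈R
    R↭B : R ↭ filter notInL? S
    R↭B = ↭-from-⊆⊇ (proj₁ (proj₂ disjoint)) (Unique.filter⁺ notInL? uniqueS)
      (λ x∈ → ∈-filter⁺ notInL? (toS (∈-++⁺ʳ L x∈)) (λ x∈L → proj₂ (proj₂ disjoint) x∈L x∈))
      (inR ∘ ∈-filter⁻ notInL?)

  lastOf∉left : ∀ b xs v l r → Sorted (b ∷ xs) → labels l ++ labels r ↭ b ∷ xs → T (andreCond (nd v l r)) →
    lastOf b xs ∉ labels l
  lastOf∉left b xs v l r sorted lr↭ andre last∈l =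
    <-irrefl refl (≤-<-trans (maxL-upper (labels l) last∈l) (<-≤-trans maxl<maxr maxr≤last))
    where
    maxl<maxr = proj₁ (andreCond-nd⁻ v l r (∈-++⁺ˡ last∈l) andre)
    maxr≤last = maxL-least (labels r)
      (All.tabulate (λ x∈ → lastOf-max b xs sorted (∈-resp-↭ lr↭ (∈-++⁺ʳ (labels l) x∈))))

  root-is-min : ∀ s S v l r → Sorted (s ∷ S) → labels (nd v l r) ↭ s ∷ S → T (increasing (nd v l r)) → v ≡ s
  root-is-min s S v l r (s< ∷ _) t↭ inc with ∈-resp-↭ t↭ (here refl) | ∈-resp-↭ (↭-sym t↭) (here refl)
  ... | here v≡s | _ = v≡s
  ... | there v∈S | here s≡v = ⊥-elim (<-irrefl s≡v (All.lookup s< v∈S))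
  ... | there v∈S | there s∈lr =
    ⊥-elim (<-asym (All.lookup s< v∈S) (All.lookup (increasing⇒root<labels v l r inc) s∈lr))

  labels-≡[] : ∀ t → labels t ≡ [] → t ≡ lf
  labels-≡[] lf _ = refl

  andreTrees-complete : ∀ f S {t} → Sorted S → length S ≤ f → AndreOn S t → t ∈ andreTrees f S
  andreTrees-complete f [] {lf} _ _ _ = here refl
  andreTrees-complete f [] {nd _ _ _} _ _ (t↭ , _) = ⊥-elim (¬x∷xs↭[] t↭)
  andreTrees-complete (suc f) (s ∷ S) {lf} _ _ (t↭ , _) = ⊥-elim (¬x∷xs↭[] (↭-sym t↭))
  andreTrees-complete (suc f) (s ∷ S) {nd v l r} sorted@(_ ∷ sortedS) (s≤s |S|≤f) (t↭ , inc , andre)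
    with root-is-min s S v l r sorted t↭ inc
  ... | refl = children S (drop-∷ t↭) sortedS |S|≤f
    where
    incl = proj₁ (proj₂ (proj₂ (increasing-nd⁻ v l r inc)))
    incr = proj₂ (proj₂ (proj₂ (increasing-nd⁻ v l r inc)))
    children : ∀ S → labels l ++ labels r ↭ S → Sorted S → length S ≤ f → nd v l r ∈ andreTrees (suc f) (v ∷ S)
    children [] lr↭ _ _ with ↭-empty-inv lr↭
    ... | lr≡[] with labels-≡[] l (++-conicalˡ (labels l) _ lr≡[]) | labels-≡[] r (++-conicalʳ (labels l) _ lr≡[])
    ...   | refl | refl = here refl
    children (b ∷ xs) lr↭ sorted-bxs |bxs|≤f with ↭-splits b xs sorted-bxs lr↭ (lastOf∉left b xs v l r sorted-bxs lr↭ andre)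
    ... | A , B , p∈ , l↭A , r↭B = ∈-andreTrees⁺ f v b xs p∈
      (andreTrees-complete f A (proj₁ (splits-AllPairs b xs p∈ sorted-bxs)) (bound (m≤m+n _ _)) (l↭A , incl , andl))
      (andreTrees-complete f B (proj₂ (splits-AllPairs b xs p∈ sorted-bxs)) (bound (m≤n+m _ _)) (r↭B , incr , andr))
      where
      bound : ∀ {k} → k ≤ length A + length B → k ≤ f
      bound k≤ = ≤-trans k≤ (≤-trans (≤-reflexive (splits-length b xs p∈)) |bxs|≤f)
      andre′ = andreCond-nd⁻ v l r (∈-resp-↭ (↭-sym lr↭) (here refl)) andre
      andl = proj₁ (proj₂ andre′)
      andr = proj₂ (proj₂ andre′)

  andreTrees-unique : ∀ f S → Sorted S → Unique (andreTrees f S)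
  andreTrees-unique f [] _ = [] ∷ []
  andreTrees-unique zero (_ ∷ _) _ = []
  andreTrees-unique (suc f) (s ∷ []) _ = [] ∷ []
  andreTrees-unique (suc f) (s ∷ b ∷ xs) (_ ∷ sorted) =
    Unique-concatMap _ (splits-unique b xs (Sorted⇒Unique sorted)) nodes-unique nodes-disjoint
    where
    sortedˡ : ∀ {p} → p ∈ splits b xs → Sorted (proj₁ p)
    sortedˡ p∈ = proj₁ (splits-AllPairs b xs p∈ sorted)
    sortedʳ : ∀ {p} → p ∈ splits b xs → Sorted (proj₂ p)
    sortedʳ p∈ = proj₂ (splits-AllPairs b xs p∈ sorted)
    nd-injective : ∀ {l l′ r r′} → nd s l r ≡ nd s l′ r′ → l ≡ l′ × r ≡ r′
    nd-injective refl = refl , refl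
    nodes-unique : ∀ {p} → p ∈ splits b xs → Unique (nodes s (andreTrees f (proj₁ p)) (andreTrees f (proj₂ p)))
    nodes-unique p∈ = Unique.cartesianProductWith⁺ (nd s) nd-injective
      (andreTrees-unique f _ (sortedˡ p∈)) (andreTrees-unique f _ (sortedʳ p∈))
    labels-determine : ∀ {X X′ u} → Sorted X → Sorted X′ → u ∈ andreTrees f X → u ∈ andreTrees f X′ → X ≡ X′
    labels-determine sX sX′ u∈ u∈′ = Sorted-↭⇒≡ sX sX′
      (↭-trans (↭-sym (proj₁ (andreTrees-sound f _ sX u∈))) (proj₁ (andreTrees-sound f _ sX′ u∈′)))
    nodes-disjoint : ∀ {p p′ t} → p ∈ splits b xs → p′ ∈ splits b xs →
      t ∈ nodes s (andreTrees f (proj₁ p)) (andreTrees f (proj₂ p)) →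
      t ∈ nodes s (andreTrees f (proj₁ p′)) (andreTrees f (proj₂ p′)) → p ≡ p′
    nodes-disjoint {A , B} {A′ , B′} p∈ p′∈ t∈ t∈′
      with ∈-cartesianProductWith⁻ (nd s) (andreTrees f A) (andreTrees f B) t∈
         | ∈-cartesianProductWith⁻ (nd s) (andreTrees f A′) (andreTrees f B′) t∈′
    ... | l , r , l∈ , r∈ , refl | _ , _ , l∈′ , r∈′ , refl =
      cong₂ _,_ (labels-determine (sortedˡ p∈) (sortedˡ p′∈) l∈ l∈′) (labels-determine (sortedʳ p∈) (sortedʳ p′∈) r∈ r∈′)

  andreTrees-fuel : ∀ f g S → Sorted S → length S ≤ f → length S ≤ g → andreTrees f S ↭ andreTrees g S
  andreTrees-fuel f g S sorted |S|≤f |S|≤g =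
    ↭-from-⊆⊇ (andreTrees-unique f S sorted) (andreTrees-unique g S sorted)
      (andreTrees-complete g S sorted |S|≤g ∘ andreTrees-sound f S sorted)
      (andreTrees-complete f S sorted |S|≤f ∘ andreTrees-sound g S sorted)

  range-sorted : ∀ n → Sorted (range n)
  range-sorted n = AllPairs.map⁺ (AllPairs.applyUpTo⁺₁ id n (λ i<j _ → s≤s i<j))

  range-length : ∀ n → length (range n) ≡ n
  range-length n = trans (length-map suc (upTo n)) (length-applyUpTo id n)

  nodes-concatMap : ∀ v L R → concatMap (λ l → map (λ r → nd v l r) R) L ≡ nodes v L R
  nodes-concatMap v [] R = refl
  nodes-concatMap v (l ∷ L) R = cong (map (nd v l) R ++_) (nodes-concatMap v L R)

  treesH-suc : ∀ n h → treesH n (suc h) ≡ lf ∷ concatMap (λ v → nodes v (treesH n h) (treesH n h)) (range n)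
  treesH-suc n h = cong (λ ts → lf ∷ concat ts) (map-cong (λ v → nodes-concatMap v (treesH n h) (treesH n h)) (range n))

  ∈-treesH⁻ : ∀ n h {t} → t ∈ treesH n (suc h) → t ≡ lf ⊎ ∃₂ λ v l → ∃ λ r →
    v ∈ range n × l ∈ treesH n h × r ∈ treesH n h × t ≡ nd v l r
  ∈-treesH⁻ n h {t} t∈ with subst (t ∈_) (treesH-suc n h) t∈
  ... | here refl = inj₁ refl
  ... | there t∈′ with ∈-concatMap-find {g = λ v → nodes v (treesH n h) (treesH n h)} {range n} t∈′
  ...   | v , v∈ , t∈″ with ∈-cartesianProductWith⁻ (nd v) (treesH n h) (treesH n h) t∈″
  ...     | l , r , l∈ , r∈ , t≡ = inj₂ (v , l , r , v∈ , l∈ , r∈ , t≡)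

  treesH-labels : ∀ n h {t} → t ∈ treesH n h → All (_∈ range n) (labels t)
  treesH-labels n zero (here refl) = []
  treesH-labels n (suc h) t∈ with ∈-treesH⁻ n h t∈
  ... | inj₁ refl = []
  ... | inj₂ (v , l , r , v∈ , l∈ , r∈ , refl) = v∈ ∷ All.++⁺ (treesH-labels n h l∈) (treesH-labels n h r∈)

  treesH-complete : ∀ n h t → All (_∈ range n) (labels t) → height t ≤ h → t ∈ treesH n h
  treesH-complete n zero lf _ _ = here refl
  treesH-complete n (suc h) lf _ _ = here refl
  treesH-complete n (suc h) (nd v l r) (v∈ ∷ lr∈) (s≤s hl⊔hr≤h) =
    subst (nd v l r ∈_) (sym (treesH-suc n h)) (there (∈-concatMap-lose v∈
      (∈-cartesianProductWith⁺ (nd v)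
        (treesH-complete n h l (All.++⁻ˡ (labels l) lr∈) (≤-trans (m≤m⊔n _ _) hl⊔hr≤h))
        (treesH-complete n h r (All.++⁻ʳ (labels l) lr∈) (≤-trans (m≤n⊔m _ _) hl⊔hr≤h)))))

  treesH-unique : ∀ n h → Unique (treesH n h)
  treesH-unique n zero = [] ∷ []
  treesH-unique n (suc h) rewrite treesH-suc n h =
    All.tabulate lf∉ ∷ Unique-concatMap nodesᵥ (Sorted⇒Unique (range-sorted n)) nodes-unique roots-differ
    where
    nodesᵥ : ℕ → List BT
    nodesᵥ v = nodes v (treesH n h) (treesH n h)
    root-of : ∀ {v t} → t ∈ nodesᵥ v → ∃₂ λ l r → t ≡ nd v l r
    root-of {v} t∈ with ∈-cartesianProductWith⁻ (nd v) (treesH n h) (treesH n h) t∈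
    ... | l , r , _ , _ , t≡ = l , r , t≡
    lf∉ : ∀ {t} → t ∈ concatMap nodesᵥ (range n) → lf ≢ t
    lf∉ t∈ lf≡t with ∈-concatMap-find {g = nodesᵥ} {range n} t∈
    ... | _ , _ , t∈′ with root-of t∈′
    ...   | _ , _ , refl with lf≡t
    ...     | ()
    nd-injective : ∀ {v l l′ r r′} → nd v l r ≡ nd v l′ r′ → l ≡ l′ × r ≡ r′
    nd-injective refl = refl , refl
    nodes-unique : ∀ {v} → v ∈ range n → Unique (nodesᵥ v)
    nodes-unique {v} _ = Unique.cartesianProductWith⁺ (nd v) nd-injective (treesH-unique n h) (treesH-unique n h)
    roots-differ : ∀ {v v′ t} → v ∈ range n → v′ ∈ range n → t ∈ nodesᵥ v → t ∈ nodesᵥ v′ → v ≡ v′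
    roots-differ _ _ t∈ t∈′ with root-of t∈ | root-of t∈′
    ... | _ , _ , refl | _ , _ , refl = refl

  indicator : Bool → ℕ
  indicator b = if b then 1 else 0

  count-↭ : ∀ i {xs ys} → xs ↭ ys → count i xs ≡ count i ys
  count-↭ i ↭.refl = refl
  count-↭ i (↭.prep x p) = cong (indicator (x ≡ᵇ i) +_) (count-↭ i p)
  count-↭ i (↭.swap {xs} x y p) =
    trans (x∙yz≈y∙xz (indicator (x ≡ᵇ i)) (indicator (y ≡ᵇ i)) (count i xs))
          (cong (λ c → indicator (y ≡ᵇ i) + (indicator (x ≡ᵇ i) + c)) (count-↭ i p))
  count-↭ i (↭.trans p q) = trans (count-↭ i p) (count-↭ i q)

  count-∉ : ∀ i xs → i ∉ xs → count i xs ≡ 0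
  count-∉ i [] _ = refl
  count-∉ i (x ∷ xs) i∉ rewrite ≡ᵇ-false x i (λ x≡i → i∉ (here (sym x≡i))) = count-∉ i xs (i∉ ∘ there)

  count-∈ : ∀ i xs → i ∈ xs → 1 ≤ count i xs
  count-∈ i (x ∷ xs) (here refl) rewrite ≡ᵇ-true x = s≤s z≤n
  count-∈ i (x ∷ xs) (there i∈) = ≤-trans (count-∈ i xs i∈) (m≤n+m _ (indicator (x ≡ᵇ i)))

  count-unique : ∀ i xs → Unique xs → i ∈ xs → count i xs ≡ 1
  count-unique i (x ∷ xs) (x∉ ∷ _) (here refl) rewrite ≡ᵇ-true x =
    cong suc (count-∉ x xs (λ x∈ → All.lookup x∉ x∈ refl))
  count-unique i (x ∷ xs) (x∉ ∷ u) (there i∈) rewrite ≡ᵇ-false x i (All.lookup x∉ i∈) = count-unique i xs u i∈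

  count≤1⇒Unique : ∀ xs → (∀ {x} → x ∈ xs → count x xs ≤ 1) → Unique xs
  count≤1⇒Unique [] _ = []
  count≤1⇒Unique (a ∷ xs) count≤1 =
    All.tabulate a∉ ∷ count≤1⇒Unique xs (λ x∈ → ≤-trans (m≤n+m _ _) (count≤1 (there x∈)))
    where
    a∉ : ∀ {x} → x ∈ xs → a ≢ x
    a∉ x∈ refl with count≤1 (here refl)
    ... | h rewrite ≡ᵇ-true a = <-irrefl refl (≤-trans (s≤s (count-∈ a xs x∈)) h)

  -- Labels drawn from [n] make the length test of vertexSet redundant.
  vertexSet⇒↭ : ∀ n t → All (_∈ range n) (labels t) → T (vertexSet n t) → labels t ↭ range n
  vertexSet⇒↭ n t ⊆range h = ↭-from-⊆⊇ unique (Sorted⇒Unique (range-sorted n)) (All.lookup ⊆range) range⊆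
    where
    once : ∀ {i} → i ∈ range n → count i (labels t) ≡ 1
    once i∈ = ≡ᵇ⇒≡ _ _ (All.lookup (All.all⁺ _ (range n) (proj₂ (T-∧⁻ h))) i∈)
    unique : Unique (labels t)
    unique = count≤1⇒Unique (labels t) (λ x∈ → ≤-reflexive (once (All.lookup ⊆range x∈)))
    range⊆ : ∀ {i} → i ∈ range n → i ∈ labels t
    range⊆ {i} i∈ with i ∈? labels t
    ... | yes i∈t = i∈t
    ... | no i∉t with trans (sym (count-∉ i (labels t) i∉t)) (once i∈)
    ...   | ()

  ↭⇒vertexSet : ∀ n t → labels t ↭ range n → T (vertexSet n t)
  ↭⇒vertexSet n t t↭ = T-∧⁺ (≡⇒≡ᵇ _ _ (trans (↭-length t↭) (range-length n)))
    (All.all⁻ _ (All.tabulate (λ {i} i∈ → ≡⇒≡ᵇ _ _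
      (trans (count-↭ i t↭) (count-unique i (range n) (Sorted⇒Unique (range-sorted n)) i∈)))))

  andreI-↭ : ∀ n → andreI (suc n) ↭ andreTrees (suc n) (range (suc n))
  andreI-↭ n = ↭-from-⊆⊇ (Unique.filter⁺ isAndreI? (treesH-unique N N)) (andreTrees-unique N (range N) sorted) ⊆ ⊇
    where
    N = suc n
    sorted = range-sorted N
    isAndreI? = λ t → T? (isAndreI N t)
    ⊆ : ∀ {t} → t ∈ andreI N → t ∈ andreTrees N (range N)
    ⊆ {t} t∈ with ∈-filter⁻ isAndreI? {xs = treesH N N} t∈
    ... | t∈H , h with T-∧⁻ h
    ...   | vs , h′ with T-∧³⁻ {rootIs 1 t} h′
    ...     | _ , inc , andre = andreTrees-complete N (range N) sorted (≤-reflexive (range-length N))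
      (vertexSet⇒↭ N t (treesH-labels N N t∈H) vs , inc , andre)
    ⊇ : ∀ {t} → t ∈ andreTrees N (range N) → t ∈ andreI N
    ⊇ {t} t∈ with andreTrees-sound N (range N) sorted t∈ | andreTrees-root N 1 (map suc (applyUpTo suc n)) t∈
    ... | t↭ , inc , andre | _ , _ , refl = ∈-filter⁺ isAndreI?
      (treesH-complete N N t (All.tabulate (∈-resp-↭ t↭)) (andreTrees-height N (range N) t∈))
      (T-∧⁺ (↭⇒vertexSet N t t↭) (T-∧⁺ tt (T-∧⁺ inc andre)))

  memL-true : ∀ i xs → i ∈ xs → memL i xs ≡ true
  memL-true i (x ∷ xs) (here refl) rewrite ≡ᵇ-true x = refl
  memL-true i (x ∷ xs) (there i∈) rewrite memL-true i xs i∈ = ∨-zeroʳ (x ≡ᵇ i)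

  memL-false : ∀ i xs → i ∉ xs → memL i xs ≡ false
  memL-false i [] _ = refl
  memL-false i (x ∷ xs) i∉ rewrite ≡ᵇ-false x i (λ x≡i → i∉ (here (sym x≡i))) = memL-false i xs (i∉ ∘ there)

  memL-∷-≢ : ∀ i v xs → v ≢ i → memL i (v ∷ xs) ≡ memL i xs
  memL-∷-≢ i v xs v≢i rewrite ≡ᵇ-false v i v≢i = refl

  subAt-root : ∀ v l r → subAt v (nd v l r) ≡ nd v l r
  subAt-root v l r rewrite ≡ᵇ-true v = refl

  subAt-left : ∀ u v l r → v ≢ u → u ∈ labels l → subAt u (nd v l r) ≡ subAt u l
  subAt-left u v l r v≢u u∈ rewrite ≡ᵇ-false v u v≢u | memL-true u (labels l) u∈ = refl

  subAt-right : ∀ u v l r → v ≢ u → u ∉ labels l → subAt u (nd v l r) ≡ subAt u r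
  subAt-right u v l r v≢u u∉ rewrite ≡ᵇ-false v u v≢u | memL-false u (labels l) u∉ = refl

  subAt-⊆ : ∀ u t {x} → x ∈ labels (subAt u t) → x ∈ labels t
  subAt-⊆ u lf x∈ = x∈
  subAt-⊆ u (nd w l r) x∈ with w ≡ᵇ u
  ... | true = x∈
  ... | false with mem u l
  ...   | true = there (∈-++⁺ˡ (subAt-⊆ u l x∈))
  ...   | false = there (∈-++⁺ʳ (labels l) (subAt-⊆ u r x∈))

  leftOf rightOf : BT → BT
  leftOf lf = lf
  leftOf (nd _ l _) = l
  rightOf lf = lf
  rightOf (nd _ _ r) = r

  rootOf : BT → Maybe ℕ
  rootOf lf = nothing
  rootOf (nd w _ _) = just w

  leftSub≡leftOf : ∀ u t → leftSub u t ≡ leftOf (subAt u t)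
  leftSub≡leftOf u t with subAt u t
  ... | nd _ _ _ = refl
  ... | lf = refl

  rightSub≡rightOf : ∀ u t → rightSub u t ≡ rightOf (subAt u t)
  rightSub≡rightOf u t with subAt u t
  ... | nd _ _ _ = refl
  ... | lf = refl

  leftChild≡rootOf : ∀ u t → leftChild u t ≡ rootOf (leftSub u t)
  leftChild≡rootOf u t with leftSub u t
  ... | nd _ _ _ = refl
  ... | lf = refl

  rightSub-⊆ : ∀ u t {x} → x ∈ labels (rightSub u t) → x ∈ labels t
  rightSub-⊆ u t x∈ rewrite rightSub≡rightOf u t = subAt-⊆ u t (rightOf-⊆ (subAt u t) x∈)
    where
    rightOf-⊆ : ∀ s {x} → x ∈ labels (rightOf s) → x ∈ labels s
    rightOf-⊆ (nd _ l _) x∈ = there (∈-++⁺ʳ (labels l) x∈)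

  leftChild-∈ : ∀ u t {c} → leftChild u t ≡ just c → c ∈ labels t
  leftChild-∈ u t c≡ rewrite leftChild≡rootOf u t | leftSub≡leftOf u t =
    subAt-⊆ u t (root∈leftOf (subAt u t) c≡)
    where
    root∈leftOf : ∀ s {c} → rootOf (leftOf s) ≡ just c → c ∈ labels s
    root∈leftOf (nd _ (nd _ _ _) r) refl = there (∈-++⁺ˡ {ys = labels r} (here refl))

  path-left : ∀ i v l r → v ≢ i → i ∈ labels l → path i (nd v l r) ≡ v ∷ path i l
  path-left i v l r v≢i i∈ rewrite ≡ᵇ-false v i v≢i | memL-true i (labels l) i∈ = refl

  path-right : ∀ i v l r → v ≢ i → i ∉ labels l → i ∈ labels r → path i (nd v l r) ≡ v ∷ path i r
  path-right i v l r v≢i i∉ i∈ rewrite ≡ᵇ-false v i v≢i | memL-false i (labels l) i∉ | memL-true i (labels r) i∈ = refl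

  path-⊆ : ∀ i t {x} → x ∈ path i t → x ∈ labels t
  path-⊆ i (nd v l r) x∈ with v ≡ᵇ i
  ... | true = ∷⁺ʳ v (λ ()) x∈
  ... | false with mem i l
  ...   | true = ∷⁺ʳ v (∈-++⁺ˡ ∘ path-⊆ i l) x∈
  ...   | false with mem i r
  ...     | true = ∷⁺ʳ v (∈-++⁺ʳ (labels l) ∘ path-⊆ i r) x∈
  ...     | false with x∈
  ...       | ()

  root∈path : ∀ i v l r → i ∈ labels (nd v l r) → v ∈ path i (nd v l r)
  root∈path i v l r (here refl) rewrite ≡ᵇ-true v = here refl
  root∈path i v l r (there i∈lr) with v ≡ᵇ i
  ... | true = here refl
  ... | false with ∈-++⁻ (labels l) i∈lr
  ...   | inj₁ i∈l rewrite memL-true i (labels l) i∈l = here refl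
  ...   | inj₂ i∈r with mem i l
  ...     | true = here refl
  ...     | false rewrite memL-true i (labels r) i∈r = here refl

  any-cong : ∀ {p q : ℕ → Bool} xs → (∀ {u} → u ∈ xs → p u ≡ q u) → any p xs ≡ any q xs
  any-cong [] _ = refl
  any-cong (x ∷ xs) p≡q = cong₂ _∨_ (p≡q (here refl)) (any-cong xs (p≡q ∘ there))

  any-false : ∀ {p : ℕ → Bool} xs → (∀ {u} → u ∈ xs → p u ≡ false) → any p xs ≡ false
  any-false [] _ = refl
  any-false (x ∷ xs) p≡false rewrite p≡false (here refl) = any-false xs (p≡false ∘ there)

  subAt≡⇒leftSub≡ : ∀ u t s → subAt u t ≡ subAt u s → leftSub u t ≡ leftSub u s
  subAt≡⇒leftSub≡ u t s e = trans (leftSub≡leftOf u t) (trans (cong leftOf e) (sym (leftSub≡leftOf u s)))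

  subAt≡⇒rightSub≡ : ∀ u t s → subAt u t ≡ subAt u s → rightSub u t ≡ rightSub u s
  subAt≡⇒rightSub≡ u t s e = trans (rightSub≡rightOf u t) (trans (cong rightOf e) (sym (rightSub≡rightOf u s)))

  subAt≡⇒leftChild≡ : ∀ u t s → subAt u t ≡ subAt u s → leftChild u t ≡ leftChild u s
  subAt≡⇒leftChild≡ u t s e =
    trans (leftChild≡rootOf u t) (trans (cong rootOf (subAt≡⇒leftSub≡ u t s e)) (sym (leftChild≡rootOf u s)))

  leftChildOnPath : Maybe ℕ → List ℕ → Bool
  leftChildOnPath nothing _ = false
  leftChildOnPath (just c) P = memL c P

  separated : BT → ℕ → ℕ → List ℕ → Bool
  separated t i j P = any (λ u → mem i (leftSub u t) ∧ mem j (rightSub u t)) P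

  invPairAlong : BT → ℕ → ℕ → List ℕ → Bool → Bool
  invPairAlong t i j P false = separated t i j P
  invPairAlong t i j P true = leftChildOnPath (leftChild j t) P

  invPair-along : ∀ t i j {P} → path i t ≡ P → invPair t i j ≡ invPairAlong t i j P (memL j P)
  invPair-along t i j refl with memL j (path i t)
  ... | false = refl
  ... | true with leftChild j t
  ...   | nothing = refl
  ...   | just c = refl

  -- The pairs (i , j) of nd v l r split according to where i and j lie: condition (2)
  -- makes every (i ∈ l , v) an inversion, condition (1) at v every (i ∈ l , j ∈ r),
  -- and pairs inside one subtree are inversions of that subtree.
  module InvPairAtNode (v : ℕ) (l r : BT) (v∉l : v ∉ labels l) (v∉r : v ∉ labels r)
                       (l∩r : ∀ {x} → x ∈ labels l → x ∉ labels r) where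
    open ≡-Reasoning

    private
      t = nd v l r

      v≢left : ∀ {i} → i ∈ labels l → v ≢ i
      v≢left i∈ refl = v∉l i∈

      v≢right : ∀ {i} → i ∈ labels r → v ≢ i
      v≢right i∈ refl = v∉r i∈

      right∉left : ∀ {i} → i ∈ labels r → i ∉ labels l
      right∉left i∈r i∈l = l∩r i∈l i∈r

      subAt-in-left : ∀ {u} → u ∈ labels l → subAt u t ≡ subAt u l
      subAt-in-left u∈ = subAt-left _ v l r (v≢left u∈) u∈

      subAt-in-right : ∀ {u} → u ∈ labels r → subAt u t ≡ subAt u r
      subAt-in-right u∈ = subAt-right _ v l r (v≢right u∈) (right∉left u∈)

      leftSub-root : leftSub v t ≡ l
      leftSub-root = trans (leftSub≡leftOf v t) (cong leftOf (subAt-root v l r))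

      rightSub-root : rightSub v t ≡ r
      rightSub-root = trans (rightSub≡rightOf v t) (cong rightOf (subAt-root v l r))

      leftChild-root : leftChild v t ≡ rootOf l
      leftChild-root = trans (leftChild≡rootOf v t) (cong rootOf leftSub-root)

      path-in-left : ∀ {i} → i ∈ labels l → path i t ≡ v ∷ path i l
      path-in-left i∈ = path-left _ v l r (v≢left i∈) i∈

      path-in-right : ∀ {i} → i ∈ labels r → path i t ≡ v ∷ path i r
      path-in-right i∈ = path-right _ v l r (v≢right i∈) (right∉left i∈) i∈

      root-test : ∀ {i j} → (mem i (leftSub v t) ∧ mem j (rightSub v t)) ≡ (mem i l ∧ mem j r)
      root-test {i} {j} = cong₂ (λ a b → mem i a ∧ mem j b) leftSub-root rightSub-root

      pair-at-root : ∀ {i} P → path i t ≡ v ∷ P → invPair t i v ≡ leftChildOnPath (rootOf l) (v ∷ P)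
      pair-at-root {i} P e = begin
        invPair t i v                                            ≡⟨ invPair-along t i v e ⟩
        invPairAlong t i v (v ∷ P) (memL v (v ∷ P))              ≡⟨ cong (invPairAlong t i v (v ∷ P)) (memL-true v (v ∷ P) (here refl)) ⟩
        leftChildOnPath (leftChild v t) (v ∷ P)                  ≡⟨ cong (λ m → leftChildOnPath m (v ∷ P)) leftChild-root ⟩
        leftChildOnPath (rootOf l) (v ∷ P)                       ∎

      pair-off-path : ∀ {i j} P → path i t ≡ v ∷ P → j ∉ v ∷ P →
        invPair t i j ≡ (mem i l ∧ mem j r) ∨ separated t i j P
      pair-off-path {i} {j} P e j∉ = begin
        invPair t i j                                ≡⟨ invPair-along t i j e ⟩
        invPairAlong t i j (v ∷ P) (memL j (v ∷ P))  ≡⟨ cong (invPairAlong t i j (v ∷ P)) (memL-false j (v ∷ P) j∉) ⟩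
        (mem i (leftSub v t) ∧ mem j (rightSub v t)) ∨ separated t i j P ≡⟨ cong (_∨ separated t i j P) root-test ⟩
        (mem i l ∧ mem j r) ∨ separated t i j P      ∎

      pair-in-child : ∀ s {i j} → path i t ≡ v ∷ path i s → j ∈ labels s → v ∉ labels s →
        (mem i l ∧ mem j r) ≡ false → (∀ {u} → u ∈ labels s → subAt u t ≡ subAt u s) →
        invPair t i j ≡ invPair s i j
      pair-in-child s {i} {j} e j∈ v∉ root-false subAt≡ = begin
        invPair t i j                                  ≡⟨ invPair-along t i j e ⟩
        invPairAlong t i j (v ∷ P) (memL j (v ∷ P))    ≡⟨ cong (invPairAlong t i j (v ∷ P)) (memL-∷-≢ j v P (λ { refl → v∉ j∈ })) ⟩
        invPairAlong t i j (v ∷ P) (memL j P)          ≡⟨ drop-root (memL j P) ⟩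
        invPairAlong s i j P (memL j P)                ≡⟨ invPair-along s i j refl ⟨
        invPair s i j                                  ∎
        where
        P = path i s
        on-s : ∀ {u} → u ∈ P → u ∈ labels s
        on-s = path-⊆ i s
        drop-root : ∀ b → invPairAlong t i j (v ∷ P) b ≡ invPairAlong s i j P b
        drop-root false = trans (cong (_∨ separated t i j P) (trans root-test root-false))
          (any-cong P (λ {u} u∈ → cong₂ (λ a b → mem i a ∧ mem j b)
            (subAt≡⇒leftSub≡ u t s (subAt≡ (on-s u∈))) (subAt≡⇒rightSub≡ u t s (subAt≡ (on-s u∈)))))
        drop-root true = trans (cong (λ m → leftChildOnPath m (v ∷ P)) (subAt≡⇒leftChild≡ j t s (subAt≡ j∈)))
          (skip-root (leftChild j s) (leftChild-∈ j s))
          where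
          skip-root : ∀ m → (∀ {c} → m ≡ just c → c ∈ labels s) → leftChildOnPath m (v ∷ P) ≡ leftChildOnPath m P
          skip-root nothing _ = refl
          skip-root (just c) c∈ = memL-∷-≢ c v P (λ { refl → v∉ (c∈ refl) })

    invPair-left-root : ∀ {i} → i ∈ labels l → invPair t i v ≡ true
    invPair-left-root {i} i∈ = trans (pair-at-root (path i l) (path-in-left i∈)) (onPath l i∈)
      where
      onPath : ∀ s → i ∈ labels s → leftChildOnPath (rootOf s) (v ∷ path i s) ≡ true
      onPath (nd c a b) i∈s = memL-true c (v ∷ path i (nd c a b)) (there (root∈path i c a b i∈s))

    invPair-right-root : ∀ {i} → i ∈ labels r → invPair t i v ≡ false
    invPair-right-root {i} i∈ = trans (pair-at-root (path i r) (path-in-right i∈)) (offPath l c∉)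
      where
      c∉ : ∀ {c} → c ∈ labels l → c ∉ v ∷ path i r
      c∉ c∈ (here refl) = v∉l c∈
      c∉ c∈ (there c∈P) = l∩r c∈ (path-⊆ i r c∈P)
      offPath : ∀ s → (∀ {c} → c ∈ labels s → c ∉ v ∷ path i r) → leftChildOnPath (rootOf s) (v ∷ path i r) ≡ false
      offPath lf _ = refl
      offPath (nd c _ _) c∉′ = memL-false c _ (c∉′ (here refl))

    invPair-left-right : ∀ {i j} → i ∈ labels l → j ∈ labels r → invPair t i j ≡ true
    invPair-left-right {i} {j} i∈ j∈ = begin
      invPair t i j                          ≡⟨ pair-off-path (path i l) (path-in-left i∈) j∉ ⟩
      (mem i l ∧ mem j r) ∨ separated t i j (path i l)
        ≡⟨ cong₂ (λ a b → (a ∧ b) ∨ separated t i j (path i l)) (memL-true i (labels l) i∈) (memL-true j (labels r) j∈) ⟩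
      true                                   ∎
      where
      j∉ : j ∉ v ∷ path i l
      j∉ (here refl) = v∉r j∈
      j∉ (there j∈P) = l∩r (path-⊆ i l j∈P) j∈

    invPair-right-left : ∀ {i j} → i ∈ labels r → j ∈ labels l → invPair t i j ≡ false
    invPair-right-left {i} {j} i∈ j∈ = begin
      invPair t i j                          ≡⟨ pair-off-path (path i r) (path-in-right i∈) j∉ ⟩
      (mem i l ∧ mem j r) ∨ separated t i j (path i r)
        ≡⟨ cong (λ a → (a ∧ mem j r) ∨ separated t i j (path i r)) (memL-false i (labels l) (right∉left i∈)) ⟩
      separated t i j (path i r)             ≡⟨ any-false (path i r) j-not-right ⟩
      false                                  ∎
      where
      j∉ : j ∉ v ∷ path i r
      j∉ (here refl) = v∉l j∈
      j∉ (there j∈P) = l∩r j∈ (path-⊆ i r j∈P)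
      j-not-right : ∀ {u} → u ∈ path i r → (mem i (leftSub u t) ∧ mem j (rightSub u t)) ≡ false
      j-not-right {u} u∈ = trans (cong (mem i (leftSub u t) ∧_) (memL-false j (labels (rightSub u t)) j∉sub)) (∧-zeroʳ _)
        where
        j∉sub : j ∉ labels (rightSub u t)
        j∉sub j∈sub = l∩r j∈ (rightSub-⊆ u r (subst (λ s → j ∈ labels s)
          (subAt≡⇒rightSub≡ u t r (subAt-in-right (path-⊆ i r u∈))) j∈sub))

    invPair-left-left : ∀ {i j} → i ∈ labels l → j ∈ labels l → invPair t i j ≡ invPair l i j
    invPair-left-left {i} {j} i∈ j∈ = pair-in-child l (path-in-left i∈) j∈ v∉l
      (trans (cong (mem i l ∧_) (memL-false j (labels r) (l∩r j∈))) (∧-zeroʳ (mem i l))) subAt-in-left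

    invPair-right-right : ∀ {i j} → i ∈ labels r → j ∈ labels r → invPair t i j ≡ invPair r i j
    invPair-right-right {i} {j} i∈ j∈ = pair-in-child r (path-in-right i∈) j∈ v∉r
      (cong (_∧ mem j r) (memL-false i (labels l) (right∉left i∈))) subAt-in-right

  -- Tree statistics along the root decomposition

  leaves-nd : ∀ s l v a b → leaves (nd s l (nd v a b)) ≡ leaves l + leaves (nd v a b)
  leaves-nd s lf v a b = refl
  leaves-nd s (nd _ _ _) v a b = refl

  oneChild-nd : ∀ s l v a b →
    oneChild (nd s l (nd v a b)) ≡ indicator (length (labels l) ≡ᵇ 0) + oneChild l + oneChild (nd v a b)
  oneChild-nd s lf v a b = refl
  oneChild-nd s (nd _ _ _) v a b = refl

  countIf : (ℕ → Bool) → List ℕ → ℕ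
  countIf Q [] = 0
  countIf Q (j ∷ Y) = indicator (Q j) + countIf Q Y

  countPairs : (ℕ → ℕ → Bool) → List ℕ → List ℕ → ℕ
  countPairs P [] Y = 0
  countPairs P (i ∷ X) Y = countIf (P i) Y + countPairs P X Y

  length-filter≡countIf : ∀ Q Y → length (filter (λ j → T? (Q j)) Y) ≡ countIf Q Y
  length-filter≡countIf Q [] = refl
  length-filter≡countIf Q (j ∷ Y) with Q j
  ... | true = cong suc (length-filter≡countIf Q Y)
  ... | false = length-filter≡countIf Q Y

  length-concatMap-filter≡countPairs : ∀ P X Y →
    length (concatMap (λ i → filter (λ j → T? (P i j)) Y) X) ≡ countPairs P X Y
  length-concatMap-filter≡countPairs P [] Y = refl
  length-concatMap-filter≡countPairs P (i ∷ X) Y =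
    trans (length-++ (filter (λ j → T? (P i j)) Y))
          (cong₂ _+_ (length-filter≡countIf (P i) Y) (length-concatMap-filter≡countPairs P X Y))

  countIf-↭ : ∀ Q {Y Y′} → Y ↭ Y′ → countIf Q Y ≡ countIf Q Y′
  countIf-↭ Q ↭.refl = refl
  countIf-↭ Q (↭.prep j p) = cong (indicator (Q j) +_) (countIf-↭ Q p)
  countIf-↭ Q (↭.swap {Y} j k p) = trans (x∙yz≈y∙xz (indicator (Q j)) (indicator (Q k)) (countIf Q Y))
    (cong (λ c → indicator (Q k) + (indicator (Q j) + c)) (countIf-↭ Q p))
  countIf-↭ Q (↭.trans p q) = trans (countIf-↭ Q p) (countIf-↭ Q q)

  countPairs-↭ˡ : ∀ P {X X′} Y → X ↭ X′ → countPairs P X Y ≡ countPairs P X′ Y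
  countPairs-↭ˡ P Y ↭.refl = refl
  countPairs-↭ˡ P Y (↭.prep i p) = cong (countIf (P i) Y +_) (countPairs-↭ˡ P Y p)
  countPairs-↭ˡ P Y (↭.swap {X} i k p) = trans (x∙yz≈y∙xz (countIf (P i) Y) (countIf (P k) Y) (countPairs P X Y))
    (cong (λ c → countIf (P k) Y + (countIf (P i) Y + c)) (countPairs-↭ˡ P Y p))
  countPairs-↭ˡ P Y (↭.trans p q) = trans (countPairs-↭ˡ P Y p) (countPairs-↭ˡ P Y q)

  countPairs-↭ʳ : ∀ P X {Y Y′} → Y ↭ Y′ → countPairs P X Y ≡ countPairs P X Y′
  countPairs-↭ʳ P [] p = refl
  countPairs-↭ʳ P (i ∷ X) p = cong₂ _+_ (countIf-↭ (P i) p) (countPairs-↭ʳ P X p)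

  countIf-++ : ∀ Q Y Y′ → countIf Q (Y ++ Y′) ≡ countIf Q Y + countIf Q Y′
  countIf-++ Q [] Y′ = refl
  countIf-++ Q (j ∷ Y) Y′ = trans (cong (indicator (Q j) +_) (countIf-++ Q Y Y′)) (sym (+-assoc (indicator (Q j)) _ _))

  countPairs-++ˡ : ∀ P X X′ Y → countPairs P (X ++ X′) Y ≡ countPairs P X Y + countPairs P X′ Y
  countPairs-++ˡ P [] X′ Y = refl
  countPairs-++ˡ P (i ∷ X) X′ Y =
    trans (cong (countIf (P i) Y +_) (countPairs-++ˡ P X X′ Y)) (sym (+-assoc (countIf (P i) Y) _ _))

  countPairs-++ʳ : ∀ P X Y Y′ → countPairs P X (Y ++ Y′) ≡ countPairs P X Y + countPairs P X Y′
  countPairs-++ʳ P [] Y Y′ = refl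
  countPairs-++ʳ P (i ∷ X) Y Y′ rewrite countIf-++ (P i) Y Y′ | countPairs-++ʳ P X Y Y′ =
    interchange (countIf (P i) Y) (countIf (P i) Y′) (countPairs P X Y) (countPairs P X Y′)

  countIf-cong : ∀ {Q Q′ : ℕ → Bool} Y → (∀ {j} → j ∈ Y → Q j ≡ Q′ j) → countIf Q Y ≡ countIf Q′ Y
  countIf-cong [] _ = refl
  countIf-cong (j ∷ Y) Q≡ = cong₂ _+_ (cong indicator (Q≡ (here refl))) (countIf-cong Y (Q≡ ∘ there))

  countPairs-cong : ∀ {P P′ : ℕ → ℕ → Bool} X Y → (∀ {i j} → i ∈ X → j ∈ Y → P i j ≡ P′ i j) →
    countPairs P X Y ≡ countPairs P′ X Y
  countPairs-cong [] Y _ = refl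
  countPairs-cong (i ∷ X) Y P≡ = cong₂ _+_ (countIf-cong Y (P≡ (here refl))) (countPairs-cong X Y (P≡ ∘ there))

  countIf-none : ∀ {Q : ℕ → Bool} Y → (∀ {j} → j ∈ Y → Q j ≡ false) → countIf Q Y ≡ 0
  countIf-none [] _ = refl
  countIf-none (j ∷ Y) none rewrite none (here refl) = countIf-none Y (none ∘ there)

  countPairs-none : ∀ {P : ℕ → ℕ → Bool} X Y → (∀ {i j} → i ∈ X → j ∈ Y → P i j ≡ false) → countPairs P X Y ≡ 0
  countPairs-none [] Y _ = refl
  countPairs-none (i ∷ X) Y none rewrite countIf-none Y (none (here refl)) = countPairs-none X Y (none ∘ there)

  countPairs-all-[_] : ∀ {P : ℕ → ℕ → Bool} X y → (∀ {i} → i ∈ X → P i y ≡ true) → countPairs P X (y ∷ []) ≡ length X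
  countPairs-all-[_] [] y _ = refl
  countPairs-all-[_] (i ∷ X) y all rewrite all (here refl) = cong suc (countPairs-all-[_] X y (all ∘ there))

  crossings : List ℕ → List ℕ → ℕ
  crossings = countPairs (λ i j → j <ᵇ i)

  crossings-∷ˡ : ∀ b A B → All (b <_) B → crossings (b ∷ A) B ≡ crossings A B
  crossings-∷ˡ b A B b<B = cong (_+ crossings A B) (countIf-none B (λ j∈ → <ᵇ-false _ b (<-asym (All.lookup b<B j∈))))

  crossings-∷ʳ : ∀ b A B → All (b <_) A → crossings A (b ∷ B) ≡ length A + crossings A B
  crossings-∷ʳ b [] B _ = refl
  crossings-∷ʳ b (i ∷ A) B (b<i ∷ b<A) rewrite <ᵇ-true b i b<i | crossings-∷ʳ b A B b<A =
    cong suc (x∙yz≈y∙xz (countIf (λ j → j <ᵇ i) B) (length A) (crossings A B))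

  invRec : BT → ℕ
  invRec lf = 0
  invRec (nd v l r) = invRec l + invRec r + crossings (labels l) (labels r) + length (labels l)

  isInvPair : BT → ℕ → ℕ → Bool
  isInvPair t i j = (j <ᵇ i) ∧ invPair t i j

  countPairs-isInvPair≡invRec : ∀ t → Unique (labels t) → T (increasing t) →
    countPairs (isInvPair t) (labels t) (labels t) ≡ invRec t
  countPairs-isInvPair≡invRec lf _ _ = refl
  countPairs-isInvPair≡invRec (nd v l r) (v∉lr ∷ unique) inc = begin
    countIf (P v) (v ∷ L ++ R) + countPairs P (L ++ R) (v ∷ L ++ R)
      ≡⟨ cong₂ _+_ root-row (countPairs-++ˡ P L R (v ∷ L ++ R)) ⟩
    0 + (countPairs P L (v ∷ L ++ R) + countPairs P R (v ∷ L ++ R))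
      ≡⟨ cong₂ _+_ (blocks L) (blocks R) ⟩
    (countPairs P L (v ∷ []) + (countPairs P L L + countPairs P L R)) +
    (countPairs P R (v ∷ []) + (countPairs P R L + countPairs P R R))
      ≡⟨ cong₂ _+_ (cong₂ _+_ left-root (cong₂ _+_ left-left left-right))
                   (cong₂ _+_ right-root (cong₂ _+_ right-left right-right)) ⟩
    (length L + (invRec l + crossings L R)) + (0 + (0 + invRec r))
      ≡⟨ solve 4 (λ a b c d → (a :+ (b :+ c)) :+ (con 0 :+ (con 0 :+ d)) := b :+ d :+ c :+ a) refl
           (length L) (invRec l) (crossings L R) (invRec r) ⟩
    invRec l + invRec r + crossings L R + length L ∎
    where
    open ≡-Reasoning
    open +-*-Solver
    t = nd v l r
    L = labels l
    R = labels r
    P = isInvPair t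
    disjoint = Unique-++⁻ L unique
    v∉l : v ∉ L
    v∉l v∈ = All.lookup (All.++⁻ˡ L v∉lr) v∈ refl
    v∉r : v ∉ R
    v∉r v∈ = All.lookup (All.++⁻ʳ L v∉lr) v∈ refl
    open InvPairAtNode v l r v∉l v∉r (proj₂ (proj₂ disjoint))
    v< = increasing⇒root<labels v l r inc
    incl = proj₁ (proj₂ (proj₂ (increasing-nd⁻ v l r inc)))
    incr = proj₂ (proj₂ (proj₂ (increasing-nd⁻ v l r inc)))
    blocks : ∀ X → countPairs P X (v ∷ L ++ R) ≡ countPairs P X (v ∷ []) + (countPairs P X L + countPairs P X R)
    blocks X = trans (countPairs-++ʳ P X (v ∷ []) (L ++ R)) (cong (countPairs P X (v ∷ []) +_) (countPairs-++ʳ P X L R))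
    root-row : countIf (P v) (v ∷ L ++ R) ≡ 0
    root-row = countIf-none (v ∷ L ++ R) λ
      { (here refl) → cong (_∧ invPair t v v) (<ᵇ-false v v (<-irrefl refl))
      ; {j} (there j∈) → cong (_∧ invPair t v j) (<ᵇ-false j v (<-asym (All.lookup v< j∈))) }
    left-root : countPairs P L (v ∷ []) ≡ length L
    left-root = countPairs-all-[_] L v (λ i∈ →
      cong₂ _∧_ (<ᵇ-true v _ (All.lookup v< (∈-++⁺ˡ i∈))) (invPair-left-root i∈))
    left-left : countPairs P L L ≡ invRec l
    left-left = trans (countPairs-cong L L (λ i∈ j∈ → cong (_ ∧_) (invPair-left-left i∈ j∈)))
      (countPairs-isInvPair≡invRec l (proj₁ disjoint) incl)
    left-right : countPairs P L R ≡ crossings L R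
    left-right = countPairs-cong L R (λ i∈ j∈ → trans (cong (_ ∧_) (invPair-left-right i∈ j∈)) (∧-identityʳ _))
    right-root : countPairs P R (v ∷ []) ≡ 0
    right-root = countPairs-none R (v ∷ []) (λ { i∈ (here refl) → trans (cong (_ ∧_) (invPair-right-root i∈)) (∧-zeroʳ _) })
    right-left : countPairs P R L ≡ 0
    right-left = countPairs-none R L (λ i∈ j∈ → trans (cong (_ ∧_) (invPair-right-left i∈ j∈)) (∧-zeroʳ _))
    right-right : countPairs P R R ≡ invRec r
    right-right = trans (countPairs-cong R R (λ i∈ j∈ → cong (_ ∧_) (invPair-right-right i∈ j∈)))
      (countPairs-isInvPair≡invRec r (proj₁ (proj₂ disjoint)) incr)

  inv≡invRec : ∀ n t → labels t ↭ range n → T (increasing t) → inv n t ≡ invRec t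
  inv≡invRec n t t↭ inc = begin
    inv n t                                                  ≡⟨ length-concatMap-filter≡countPairs (isInvPair t) (range n) (range n) ⟩
    countPairs (isInvPair t) (range n) (range n)             ≡⟨ countPairs-↭ˡ (isInvPair t) (range n) (↭-sym t↭) ⟩
    countPairs (isInvPair t) (labels t) (range n)            ≡⟨ countPairs-↭ʳ (isInvPair t) (labels t) (↭-sym t↭) ⟩
    countPairs (isInvPair t) (labels t) (labels t)
      ≡⟨ countPairs-isInvPair≡invRec t (Unique-resp-↭ (↭-sym t↭) (Sorted⇒Unique (range-sorted n))) inc ⟩
    invRec t                                                 ∎
    where open ≡-Reasoning

module WeightSums {c ℓ : Level} (R : CommutativeRing c ℓ) where

  open Trees
  open CommutativeRing R hiding (zero) renaming (refl to ≈-refl; sym to ≈-sym; trans to ≈-trans; reflexive to ≈-reflexive)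
  open import Relation.Binary.Reasoning.Setoid setoid
  open import Algebra.Solver.Ring.NaturalCoefficients.Default commutativeSemiring using (solve; _:+_; _:*_; _:=_)
  open import Function using (_∘_)
  open import Data.Product using (_,_; proj₁; proj₂)
  open import Data.Nat using (zero; _<_; _≡ᵇ_) renaming (_+_ to _+ℕ_)
  open import Data.Nat.Properties using (≤-refl; ≤-trans; ≤-pred; m≤n⇒m≤1+n; m∸n≤m; n∸n≡0; suc-injective; n≤1+n; _<?_; ≮⇒≥)
  open import Relation.Nullary using (yes; no)
  open import Data.List using (List; []; _∷_; concatMap; length; applyUpTo; _++_; cartesianProductWith)
  open import Data.List.Properties using (map-++; map-∘; map-applyUpTo; map-upTo; upTo-∷ʳ)
  open import Data.List.Membership.Propositional using (_∈_)
  open import Data.List.Membership.Propositional.Properties using (∈-upTo⁻)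
  open import Data.List.Relation.Unary.Any using (here; there)
  open import Data.List.Relation.Unary.AllPairs using (_∷_)
  open import Data.List.Relation.Binary.Subset.Propositional.Properties using (All-resp-⊇)
  open import Data.List.Relation.Binary.Permutation.Propositional using (_↭_)
  import Data.List.Relation.Binary.Permutation.Propositional as ↭
  open import Data.List.Relation.Binary.Permutation.Propositional.Properties using (∈-resp-↭; ↭-length) renaming (map⁺ to ↭-map⁺)
  import Data.List.Relation.Binary.Permutation.Setoid.Properties as ↭ₛ
  open import Relation.Binary.PropositionalEquality using (_≡_)
  import Relation.Binary.PropositionalEquality as ≡

  Σ : List Carrier → Carrier
  Σ = ΣR R

  Σ-++ : ∀ xs ys → Σ (xs ++ ys) ≈ Σ xs + Σ ys
  Σ-++ [] ys = ≈-sym (+-identityˡ _)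
  Σ-++ (x ∷ xs) ys = ≈-trans (+-congˡ (Σ-++ xs ys)) (≈-sym (+-assoc x _ _))

  Σ-↭ : ∀ {xs ys} → xs ↭ ys → Σ xs ≈ Σ ys
  Σ-↭ p = ↭ₛ.foldr-commMonoid setoid +-isCommutativeMonoid (↭.↭⇒↭ₛ′ isEquivalence p)

  Σ-cong : ∀ {A : Set} (xs : List A) {f g : A → Carrier} → (∀ {a} → a ∈ xs → f a ≈ g a) →
    Σ (map f xs) ≈ Σ (map g xs)
  Σ-cong [] _ = ≈-refl
  Σ-cong (a ∷ xs) f≈g = +-cong (f≈g (here ≡.refl)) (Σ-cong xs (f≈g ∘ there))

  Σ-+ : ∀ {A : Set} (xs : List A) (f g : A → Carrier) → Σ (map (λ a → f a + g a) xs) ≈ Σ (map f xs) + Σ (map g xs)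
  Σ-+ [] f g = ≈-sym (+-identityʳ _)
  Σ-+ (a ∷ xs) f g = ≈-trans (+-congˡ (Σ-+ xs f g))
    (solve 4 (λ a b c d → (a :+ b) :+ (c :+ d) := (a :+ c) :+ (b :+ d)) ≈-refl (f a) (g a) (Σ (map f xs)) (Σ (map g xs)))

  Σ-*ˡ : ∀ {A : Set} (xs : List A) k (f : A → Carrier) → Σ (map (λ a → k * f a) xs) ≈ k * Σ (map f xs)
  Σ-*ˡ [] k f = ≈-sym (zeroʳ k)
  Σ-*ˡ (a ∷ xs) k f = ≈-trans (+-congˡ (Σ-*ˡ xs k f)) (≈-sym (distribˡ k _ _))

  Σ-*ʳ : ∀ {A : Set} (xs : List A) (f : A → Carrier) k → Σ (map (λ a → f a * k) xs) ≈ Σ (map f xs) * k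
  Σ-*ʳ [] f k = ≈-sym (zeroˡ k)
  Σ-*ʳ (a ∷ xs) f k = ≈-trans (+-congˡ (Σ-*ʳ xs f k)) (≈-sym (distribʳ k _ _))

  Σ-map-++ : ∀ {A : Set} (f : A → Carrier) xs ys → Σ (map f (xs ++ ys)) ≈ Σ (map f xs) + Σ (map f ys)
  Σ-map-++ f xs ys = ≈-trans (≈-reflexive (≡.cong Σ (map-++ f xs ys))) (Σ-++ (map f xs) (map f ys))

  Σ-concatMap : ∀ {A B : Set} (h : B → Carrier) (g : A → List B) xs →
    Σ (map h (concatMap g xs)) ≈ Σ (map (λ a → Σ (map h (g a))) xs)
  Σ-concatMap h g [] = ≈-refl
  Σ-concatMap h g (a ∷ xs) = ≈-trans (Σ-map-++ h (g a) (concatMap g xs)) (+-congˡ (Σ-concatMap h g xs))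

  Σ-cartesianProductWith : ∀ {A B C : Set} (f : A → B → C) (h : C → Carrier) (g₁ : A → Carrier) (g₂ : B → Carrier) xs ys →
    (∀ {a b} → a ∈ xs → b ∈ ys → h (f a b) ≈ g₁ a * g₂ b) →
    Σ (map h (cartesianProductWith f xs ys)) ≈ Σ (map g₁ xs) * Σ (map g₂ ys)
  Σ-cartesianProductWith f h g₁ g₂ [] ys _ = ≈-sym (zeroˡ _)
  Σ-cartesianProductWith f h g₁ g₂ (a ∷ xs) ys h≈ = begin
    Σ (map h (map (f a) ys ++ cartesianProductWith f xs ys))
      ≈⟨ Σ-map-++ h (map (f a) ys) _ ⟩
    Σ (map h (map (f a) ys)) + Σ (map h (cartesianProductWith f xs ys))
      ≈⟨ +-cong (≈-reflexive (≡.cong Σ (≡.sym (map-∘ ys)))) (Σ-cartesianProductWith f h g₁ g₂ xs ys (h≈ ∘ there)) ⟩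
    Σ (map (h ∘ f a) ys) + Σ (map g₁ xs) * Σ (map g₂ ys)
      ≈⟨ +-congʳ (≈-trans (Σ-cong ys (h≈ (here ≡.refl))) (Σ-*ˡ ys (g₁ a) g₂)) ⟩
    g₁ a * Σ (map g₂ ys) + Σ (map g₁ xs) * Σ (map g₂ ys)
      ≈⟨ distribʳ _ _ _ ⟨
    Σ (map g₁ (a ∷ xs)) * Σ (map g₂ ys) ∎

  Σ-upTo-suc : ∀ n (g : ℕ → Carrier) → Σ (map g (upTo (suc n))) ≈ g 0 + Σ (map (g ∘ suc) (upTo n))
  Σ-upTo-suc n g = +-congˡ (≈-reflexive (≡.cong Σ (≡.trans (map-applyUpTo suc g n) (≡.sym (map-upTo (g ∘ suc) n)))))

  Σ-upTo-∷ʳ : ∀ n (g : ℕ → Carrier) → Σ (map g (upTo (suc n))) ≈ Σ (map g (upTo n)) + g n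
  Σ-upTo-∷ʳ n g = begin
    Σ (map g (upTo (suc n)))         ≡⟨ ≡.cong (Σ ∘ map g) (upTo-∷ʳ n) ⟨
    Σ (map g (upTo n ++ n ∷ []))     ≈⟨ Σ-map-++ g (upTo n) (n ∷ []) ⟩
    Σ (map g (upTo n)) + (g n + 0#)  ≈⟨ +-congˡ (+-identityʳ (g n)) ⟩
    Σ (map g (upTo n)) + g n         ∎

  pow-+ : ∀ a m n → pow R a (m +ℕ n) ≈ pow R a m * pow R a n
  pow-+ a zero n = ≈-sym (*-identityˡ _)
  pow-+ a (suc m) n = ≈-trans (*-congˡ (pow-+ a m n)) (≈-sym (*-assoc a _ _))

  -- Gaussian binomial coefficients

  m∸n≡1+[m∸[1+n]] : ∀ {m n} → n < m → m ∸ n ≡ suc (m ∸ suc n)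
  m∸n≡1+[m∸[1+n]] {suc m} {zero} _ = ≡.refl
  m∸n≡1+[m∸[1+n]] {suc m} {suc n} (s≤s n<m) = m∸n≡1+[m∸[1+n]] n<m

  module _ (q : Carrier) where

    qbinom-above : ∀ m k → m < k → qbinom R q m k ≈ 0#
    qbinom-above zero (suc k) _ = ≈-refl
    qbinom-above (suc m) (suc k) (s≤s m<1+k) = begin
      qbinom R q m k + pow R q (suc k) * qbinom R q m (suc k)
        ≈⟨ +-cong (qbinom-above m k m<1+k) (*-congˡ (qbinom-above m (suc k) (≤-trans m<1+k (n≤1+n k)))) ⟩
      0# + pow R q (suc k) * 0#   ≈⟨ +-identityˡ _ ⟩
      pow R q (suc k) * 0#        ≈⟨ zeroʳ _ ⟩
      0#                          ∎

    qbinom-diag : ∀ m → qbinom R q m m ≈ 1#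
    qbinom-diag zero = ≈-refl
    qbinom-diag (suc m) = begin
      qbinom R q m m + pow R q (suc m) * qbinom R q m (suc m)
        ≈⟨ +-cong (qbinom-diag m) (*-congˡ (qbinom-above m (suc m) ≤-refl)) ⟩
      1# + pow R q (suc m) * 0#   ≈⟨ +-congˡ (zeroʳ _) ⟩
      1# + 0#                     ≈⟨ +-identityʳ 1# ⟩
      1#                          ∎

    pow-exchange : ∀ m k → k < m → pow R q (suc (suc k)) * pow R q (m ∸ suc k) ≈ pow R q (m ∸ k) * pow R q (suc k)
    pow-exchange m k k<m rewrite m∸n≡1+[m∸[1+n]] k<m =
      solve 3 (λ q a b → (q :* a) :* b := (q :* b) :* a) ≈-refl q (pow R q (suc k)) (pow R q (m ∸ suc k))

    qbinom-pascal′ : ∀ m k → qbinom R q (suc m) (suc k) ≈ pow R q (m ∸ k) * qbinom R q m k + qbinom R q m (suc k)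
    qbinom-pascal′ zero zero = begin
      1# + (q * 1#) * 0#   ≈⟨ +-congˡ (zeroʳ _) ⟩
      1# + 0#              ≈⟨ +-congʳ (*-identityˡ 1#) ⟨
      1# * 1# + 0#         ∎
    qbinom-pascal′ zero (suc k) = begin
      0# + pow R q (suc (suc k)) * 0#   ≈⟨ +-congˡ (zeroʳ _) ⟩
      0# + 0#                           ≈⟨ +-congʳ (zeroʳ 1#) ⟨
      1# * 0# + 0#                      ∎
    qbinom-pascal′ (suc m) zero = begin
      1# + (q * 1#) * qbinom R q (suc m) 1
        ≈⟨ +-congˡ (*-cong (*-identityʳ q) (≈-trans (qbinom-pascal′ m zero) (+-congʳ (*-identityʳ _)))) ⟩
      1# + q * (pow R q m + qbinom R q m 1)
        ≈⟨ solve 4 (λ o q a b → o :+ q :* (a :+ b) := q :* a :+ (o :+ q :* b)) ≈-refl 1# q (pow R q m) (qbinom R q m 1) ⟩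
      q * pow R q m + (1# + q * qbinom R q m 1)
        ≈⟨ +-cong (*-identityʳ _) (+-congˡ (*-congʳ (*-identityʳ q))) ⟨
      (q * pow R q m) * 1# + (1# + (q * 1#) * qbinom R q m 1) ∎
    qbinom-pascal′ (suc m) (suc k) = begin
      qbinom R q (suc m) (suc k) + Q₂ * qbinom R q (suc m) (suc (suc k))
        ≈⟨ +-cong (qbinom-pascal′ m k) (*-congˡ (qbinom-pascal′ m (suc k))) ⟩
      (A * B₀ + B₁) + Q₂ * (pow R q (m ∸ suc k) * B₁ + B₂)
        ≈⟨ solve 6 (λ A B₀ B₁ B₂ Q₂ P → (A :* B₀ :+ B₁) :+ Q₂ :* (P :* B₁ :+ B₂)
                                       := A :* B₀ :+ B₁ :+ (Q₂ :* P) :* B₁ :+ Q₂ :* B₂)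
             ≈-refl A B₀ B₁ B₂ Q₂ (pow R q (m ∸ suc k)) ⟩
      A * B₀ + B₁ + (Q₂ * pow R q (m ∸ suc k)) * B₁ + Q₂ * B₂
        ≈⟨ +-congʳ (+-congˡ exchanged) ⟩
      A * B₀ + B₁ + (A * Q₁) * B₁ + Q₂ * B₂
        ≈⟨ solve 6 (λ A B₀ B₁ B₂ Q₂ Q₁ → A :* B₀ :+ B₁ :+ (A :* Q₁) :* B₁ :+ Q₂ :* B₂
                                        := A :* (B₀ :+ Q₁ :* B₁) :+ (B₁ :+ Q₂ :* B₂))
             ≈-refl A B₀ B₁ B₂ Q₂ Q₁ ⟩
      A * (B₀ + Q₁ * B₁) + (B₁ + Q₂ * B₂) ∎
      where
      A = pow R q (m ∸ k)
      B₀ = qbinom R q m k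
      B₁ = qbinom R q m (suc k)
      B₂ = qbinom R q m (suc (suc k))
      Q₁ = pow R q (suc k)
      Q₂ = pow R q (suc (suc k))
      exchanged : (Q₂ * pow R q (m ∸ suc k)) * B₁ ≈ (A * Q₁) * B₁
      exchanged with k <? m
      ... | yes k<m = *-congʳ (pow-exchange m k k<m)
      ... | no k≮m = begin
        (Q₂ * pow R q (m ∸ suc k)) * B₁   ≈⟨ *-congˡ B₁≈0 ⟩
        (Q₂ * pow R q (m ∸ suc k)) * 0#   ≈⟨ zeroʳ _ ⟩
        0#                                ≈⟨ zeroʳ _ ⟨
        (A * Q₁) * 0#                     ≈⟨ *-congˡ B₁≈0 ⟨
        (A * Q₁) * B₁                     ∎
        where B₁≈0 = qbinom-above m (suc k) (s≤s (≮⇒≥ k≮m))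

    -- φ a b is evaluated at the sizes a = m ∸ k and b = suc k of the two parts of a split of m + 1 elements.
    binomialSum : ℕ → (ℕ → ℕ → Carrier) → Carrier
    binomialSum m φ = Σ (map (λ k → qbinom R q m k * φ (m ∸ k) (suc k)) (upTo (suc m)))

    binomialSum-cong : ∀ m {φ φ′} → (∀ {k} → k ≤ m → φ (m ∸ k) (suc k) ≈ φ′ (m ∸ k) (suc k)) →
      binomialSum m φ ≈ binomialSum m φ′
    binomialSum-cong m φ≈φ′ = Σ-cong (upTo (suc m)) (λ k∈ → *-congˡ (φ≈φ′ (≤-pred (∈-upTo⁻ k∈))))

    binomialSum-suc : ∀ m φ → binomialSum (suc m) φ ≈
      binomialSum m (λ a b → φ (suc a) b) + binomialSum m (λ a b → pow R q a * φ a (suc b))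
    binomialSum-suc m φ = begin
      binomialSum (suc m) φ
        ≈⟨ Σ-upTo-suc (suc m) (λ k → qbinom R q (suc m) k * φ (suc m ∸ k) (suc k)) ⟩
      first + Σ (map (λ k → qbinom R q (suc m) (suc k) * Φ k) (upTo (suc m)))
        ≈⟨ +-congˡ (Σ-cong (upTo (suc m)) (λ {k} _ → split-term k)) ⟩
      first + Σ (map (λ k → qbinom R q m k * (pow R q (m ∸ k) * Φ k) + qbinom R q m (suc k) * Φ k) (upTo (suc m)))
        ≈⟨ +-congˡ (Σ-+ (upTo (suc m)) (λ k → qbinom R q m k * (pow R q (m ∸ k) * Φ k)) (λ k → qbinom R q m (suc k) * Φ k)) ⟩
      first + (binomialSum m φ₂ + Σ (map (λ k → qbinom R q m (suc k) * Φ k) (upTo (suc m))))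
        ≈⟨ +-congˡ (+-congˡ drop-last) ⟩
      first + (binomialSum m φ₂ + rest)
        ≈⟨ solve 3 (λ a b c → a :+ (b :+ c) := (a :+ c) :+ b) ≈-refl first (binomialSum m φ₂) rest ⟩
      (first + rest) + binomialSum m φ₂
        ≈⟨ +-congʳ (Σ-upTo-suc m (λ k → qbinom R q m k * φ₁ (m ∸ k) (suc k))) ⟨
      binomialSum m φ₁ + binomialSum m φ₂ ∎
      where
      φ₁ = λ a b → φ (suc a) b
      φ₂ = λ a b → pow R q a * φ a (suc b)
      Φ : ℕ → Carrier
      Φ k = φ (m ∸ k) (suc (suc k))
      first = qbinom R q m 0 * φ (suc m) 1
      rest = Σ (map (λ k → qbinom R q m (suc k) * φ₁ (m ∸ suc k) (suc (suc k))) (upTo m))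
      split-term : ∀ k → qbinom R q (suc m) (suc k) * Φ k ≈ qbinom R q m k * (pow R q (m ∸ k) * Φ k) + qbinom R q m (suc k) * Φ k
      split-term k = begin
        qbinom R q (suc m) (suc k) * Φ k
          ≈⟨ *-congʳ (qbinom-pascal′ m k) ⟩
        (pow R q (m ∸ k) * qbinom R q m k + qbinom R q m (suc k)) * Φ k
          ≈⟨ solve 4 (λ p b b′ f → (p :* b :+ b′) :* f := b :* (p :* f) :+ b′ :* f) ≈-refl
               (pow R q (m ∸ k)) (qbinom R q m k) (qbinom R q m (suc k)) (Φ k) ⟩
        qbinom R q m k * (pow R q (m ∸ k) * Φ k) + qbinom R q m (suc k) * Φ k ∎
      drop-last : Σ (map (λ k → qbinom R q m (suc k) * Φ k) (upTo (suc m))) ≈ rest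
      drop-last = begin
        Σ (map (λ k → qbinom R q m (suc k) * Φ k) (upTo (suc m)))
          ≈⟨ Σ-upTo-∷ʳ m (λ k → qbinom R q m (suc k) * Φ k) ⟩
        Σ (map (λ k → qbinom R q m (suc k) * Φ k) (upTo m)) + qbinom R q m (suc m) * Φ m
          ≈⟨ +-cong (Σ-cong (upTo m) (λ {k} k∈ →
                      *-congˡ (≈-reflexive (≡.cong (λ a → φ a (suc (suc k))) (m∸n≡1+[m∸[1+n]] (∈-upTo⁻ k∈))))))
                    (≈-trans (*-congʳ (qbinom-above m (suc m) ≤-refl)) (zeroˡ _)) ⟩
        rest + 0#
          ≈⟨ +-identityʳ rest ⟩
        rest ∎

  -- Weight sums of André trees

  module _ (q x y : Carrier) where

    weight : BT → Carrier
    weight t = pow R x (leaves t) * pow R y (oneChild t) * pow R q (invRec t)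

    weightSum : ℕ → List ℕ → Carrier
    weightSum f S = Σ (map weight (andreTrees f S))

    -- The factor a root contributes given the size a of its left subtree: as the right subtree
    -- is non-empty, the root has one child iff a = 0, and its a left descendants are inversions with it.
    rootFactor : ℕ → Carrier
    rootFactor a = pow R y (indicator (a ≡ᵇ 0)) * pow R q a

    weight-nd : ∀ s l v a b → let r = nd v a b in
      weight (nd s l r) ≈ pow R q (crossings (labels l) (labels r)) * (rootFactor (length (labels l)) * weight l * weight r)
    weight-nd s l v a b = begin
      pow R x (leaves (nd s l r)) * pow R y (oneChild (nd s l r)) * pow R q (invRec l +ℕ invRec r +ℕ C +ℕ N)
        ≡⟨ ≡.cong₂ (λ e f → pow R x e * pow R y f * pow R q (invRec l +ℕ invRec r +ℕ C +ℕ N))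
                   (leaves-nd s l v a b) (oneChild-nd s l v a b) ⟩
      pow R x (leaves l +ℕ leaves r) * pow R y (D +ℕ oneChild l +ℕ oneChild r) * pow R q (invRec l +ℕ invRec r +ℕ C +ℕ N)
        ≈⟨ *-cong (*-cong (pow-+ x (leaves l) (leaves r))
                           (≈-trans (pow-+ y (D +ℕ oneChild l) (oneChild r)) (*-congʳ (pow-+ y D (oneChild l)))))
                  (≈-trans (pow-+ q (invRec l +ℕ invRec r +ℕ C) N)
                    (*-congʳ (≈-trans (pow-+ q (invRec l +ℕ invRec r) C) (*-congʳ (pow-+ q (invRec l) (invRec r)))))) ⟩
      (Xl * Xr) * ((Yd * Yl) * Yr) * (((Ql * Qr) * Qc) * Qn)
        ≈⟨ solve 9 (λ Xl Xr Yd Yl Yr Ql Qr Qc Qn →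
              (Xl :* Xr) :* ((Yd :* Yl) :* Yr) :* (((Ql :* Qr) :* Qc) :* Qn)
              := Qc :* ((Yd :* Qn) :* (Xl :* Yl :* Ql) :* (Xr :* Yr :* Qr)))
             ≈-refl Xl Xr Yd Yl Yr Ql Qr Qc Qn ⟩
      Qc * (rootFactor N * weight l * weight r) ∎
      where
      r = nd v a b
      C = crossings (labels l) (labels r)
      N = length (labels l)
      D = indicator (N ≡ᵇ 0)
      Xl = pow R x (leaves l)
      Xr = pow R x (leaves r)
      Yd = pow R y D
      Yl = pow R y (oneChild l)
      Yr = pow R y (oneChild r)
      Ql = pow R q (invRec l)
      Qr = pow R q (invRec r)
      Qc = pow R q C
      Qn = pow R q N

    weightSum-nodes : ∀ f s b xs {A B} → Sorted (b ∷ xs) → (A , B) ∈ splits b xs →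
      Σ (map weight (nodes s (andreTrees f A) (andreTrees f B))) ≈
      pow R q (crossings A B) * (rootFactor (length A) * weightSum f A * weightSum f B)
    weightSum-nodes f s b xs {A} {B} sorted p∈ = begin
      Σ (map weight (nodes s (andreTrees f A) (andreTrees f B)))
        ≈⟨ Σ-cartesianProductWith (nd s) weight (λ l → K * weight l) weight (andreTrees f A) (andreTrees f B) weight-pair ⟩
      Σ (map (λ l → K * weight l) (andreTrees f A)) * weightSum f B
        ≈⟨ *-congʳ (Σ-*ˡ (andreTrees f A) K weight) ⟩
      (K * weightSum f A) * weightSum f B
        ≈⟨ solve 4 (λ c r a b → ((c :* r) :* a) :* b := c :* ((r :* a) :* b)) ≈-refl
             (pow R q (crossings A B)) (rootFactor (length A)) (weightSum f A) (weightSum f B) ⟩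
      pow R q (crossings A B) * (rootFactor (length A) * weightSum f A * weightSum f B) ∎
      where
      K = pow R q (crossings A B) * rootFactor (length A)
      l↭ : ∀ {l} → l ∈ andreTrees f A → labels l ↭ A
      l↭ l∈ = proj₁ (andreTrees-sound f A (proj₁ (splits-AllPairs b xs p∈ sorted)) l∈)
      r↭ : ∀ {r} → r ∈ andreTrees f B → labels r ↭ B
      r↭ r∈ = proj₁ (andreTrees-sound f B (proj₂ (splits-AllPairs b xs p∈ sorted)) r∈)
      weight-pair : ∀ {l r} → l ∈ andreTrees f A → r ∈ andreTrees f B → weight (nd s l r) ≈ K * weight l * weight r
      weight-pair {l} {r} l∈ r∈ with andreTrees-nd f (splits-lastOf∈ʳ b xs p∈) r∈
      ... | v , a′ , b′ , ≡.refl = begin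
        weight (nd s l r)
          ≈⟨ weight-nd s l v a′ b′ ⟩
        pow R q (crossings (labels l) (labels r)) * (rootFactor (length (labels l)) * weight l * weight r)
          ≡⟨ ≡.cong₂ (λ c n → pow R q c * (rootFactor n * weight l * weight r))
               (≡.trans (countPairs-↭ˡ _ (labels r) (l↭ l∈)) (countPairs-↭ʳ _ A (r↭ r∈))) (↭-length (l↭ l∈)) ⟩
        pow R q (crossings A B) * (rootFactor (length A) * weight l * weight r)
          ≈⟨ solve 4 (λ c n u w → c :* ((n :* u) :* w) := ((c :* n) :* u) :* w) ≈-refl
               (pow R q (crossings A B)) (rootFactor (length A)) (weight l) (weight r) ⟩
        K * weight l * weight r ∎

    weightSum-split : ∀ f s b xs → Sorted (b ∷ xs) → weightSum (suc f) (s ∷ b ∷ xs) ≈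
      Σ (map (λ p → pow R q (crossings (proj₁ p) (proj₂ p)) *
                    (rootFactor (length (proj₁ p)) * weightSum f (proj₁ p) * weightSum f (proj₂ p))) (splits b xs))
    weightSum-split f s b xs sorted =
      ≈-trans (Σ-concatMap weight (λ p → nodes s (andreTrees f (proj₁ p)) (andreTrees f (proj₂ p))) (splits b xs))
              (Σ-cong (splits b xs) (weightSum-nodes f s b xs sorted))

    Σ-splits : ∀ b xs → Sorted (b ∷ xs) → ∀ φ →
      Σ (map (λ p → pow R q (crossings (proj₁ p) (proj₂ p)) * φ (length (proj₁ p)) (length (proj₂ p))) (splits b xs))
      ≈ binomialSum q (length xs) φ
    Σ-splits b [] _ φ = ≈-refl
    Σ-splits b (c ∷ xs) (b< ∷ sorted) φ = begin
      Σ (map term (map (addˡ b) S ++ map (addʳ b) S))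
        ≈⟨ Σ-map-++ term (map (addˡ b) S) (map (addʳ b) S) ⟩
      Σ (map term (map (addˡ b) S)) + Σ (map term (map (addʳ b) S))
        ≡⟨ ≡.cong₂ (λ u v → Σ u + Σ v) (≡.sym (map-∘ S)) (≡.sym (map-∘ S)) ⟩
      Σ (map (term ∘ addˡ b) S) + Σ (map (term ∘ addʳ b) S)
        ≈⟨ +-cong (Σ-cong S moved-left) (Σ-cong S moved-right) ⟩
      Σ (map (termWith φ₁) S) + Σ (map (termWith φ₂) S)
        ≈⟨ +-cong (Σ-splits c xs sorted φ₁) (Σ-splits c xs sorted φ₂) ⟩
      binomialSum q (length xs) φ₁ + binomialSum q (length xs) φ₂
        ≈⟨ binomialSum-suc q (length xs) φ ⟨
      binomialSum q (suc (length xs)) φ ∎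
      where
      S = splits c xs
      termWith : (ℕ → ℕ → Carrier) → Split → Carrier
      termWith ψ p = pow R q (crossings (proj₁ p) (proj₂ p)) * ψ (length (proj₁ p)) (length (proj₂ p))
      term = termWith φ
      φ₁ = λ a b → φ (suc a) b
      φ₂ = λ a b → pow R q a * φ a (suc b)
      moved-left : ∀ {p} → p ∈ S → term (addˡ b p) ≈ termWith φ₁ p
      moved-left {A , B} p∈ = ≈-reflexive (≡.cong (λ e → pow R q e * φ (suc (length A)) (length B))
        (crossings-∷ˡ b A B (All-resp-⊇ (splits-⊆ʳ c xs p∈) b<)))
      moved-right : ∀ {p} → p ∈ S → term (addʳ b p) ≈ termWith φ₂ p
      moved-right {A , B} p∈ = begin
        pow R q (crossings A (b ∷ B)) * Φ
          ≡⟨ ≡.cong (λ e → pow R q e * Φ) (crossings-∷ʳ b A B (All-resp-⊇ (splits-⊆ˡ c xs p∈) b<)) ⟩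
        pow R q (length A +ℕ crossings A B) * Φ
          ≈⟨ *-congʳ (pow-+ q (length A) (crossings A B)) ⟩
        (pow R q (length A) * pow R q (crossings A B)) * Φ
          ≈⟨ solve 3 (λ a c f → (a :* c) :* f := c :* (a :* f)) ≈-refl (pow R q (length A)) (pow R q (crossings A B)) Φ ⟩
        termWith φ₂ (A , B) ∎
        where Φ = φ (length A) (suc (length B))

    -- The weight sum only depends on the number of labels; ψ f is the resulting summand.
    ψ : ℕ → ℕ → ℕ → Carrier
    ψ f a b = rootFactor a * weightSum f (range a) * weightSum f (range b)

    mutual
      weightSum-rec : ∀ f s b xs → Sorted (s ∷ b ∷ xs) → weightSum (suc f) (s ∷ b ∷ xs) ≈ binomialSum q (length xs) (ψ f)
      weightSum-rec f s b xs (_ ∷ sorted) = begin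
        weightSum (suc f) (s ∷ b ∷ xs)
          ≈⟨ weightSum-split f s b xs sorted ⟩
        Σ (map (λ p → pow R q (crossings (proj₁ p) (proj₂ p)) *
                      (rootFactor (length (proj₁ p)) * weightSum f (proj₁ p) * weightSum f (proj₂ p))) (splits b xs))
          ≈⟨ Σ-cong (splits b xs) (λ {p} p∈ → *-congˡ (*-cong
               (*-congˡ (weightSum-shape f (proj₁ p) (proj₁ (splits-AllPairs b xs p∈ sorted))))
               (weightSum-shape f (proj₂ p) (proj₂ (splits-AllPairs b xs p∈ sorted))))) ⟩
        Σ (map (λ p → pow R q (crossings (proj₁ p) (proj₂ p)) * ψ f (length (proj₁ p)) (length (proj₂ p))) (splits b xs))
          ≈⟨ Σ-splits b xs sorted (ψ f) ⟩
        binomialSum q (length xs) (ψ f) ∎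

      weightSum-shape : ∀ f S → Sorted S → weightSum f S ≈ weightSum f (range (length S))
      weightSum-shape f [] _ = ≈-refl
      weightSum-shape zero (_ ∷ _) _ = ≈-refl
      weightSum-shape (suc f) (s ∷ []) _ = ≈-refl
      weightSum-shape (suc f) (s ∷ b ∷ xs) sorted =
        ≈-trans (weightSum-rec f s b xs sorted) (≈-sym (weightSum-range-rec f (length xs)))

      weightSum-range-rec : ∀ f m → weightSum (suc f) (range (suc (suc m))) ≈ binomialSum q m (ψ f)
      weightSum-range-rec f m = ≈-trans (weightSum-rec f 1 2 tail (range-sorted (suc (suc m))))
        (≈-reflexive (≡.cong (λ n → binomialSum q n (ψ f)) |tail|≡))
        where
        tail = map suc (applyUpTo (λ i → suc (suc i)) m)
        |tail|≡ : length tail ≡ m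
        |tail|≡ = suc-injective (suc-injective (range-length (suc (suc m))))

    weightSum-fuel : ∀ f g S → Sorted S → length S ≤ f → length S ≤ g → weightSum f S ≈ weightSum g S
    weightSum-fuel f g S sorted |S|≤f |S|≤g = Σ-↭ (↭-map⁺ weight (andreTrees-fuel f g S sorted |S|≤f |S|≤g))

    E : ℕ → Carrier
    E n = weightSum n (range n)

    E-zero : E 0 ≈ 1#
    E-zero = ≈-trans (+-identityʳ _) (≈-trans (*-identityʳ _) (*-identityʳ 1#))

    EI≈E : ∀ n → EI R q x y (suc n) ≈ E (suc n)
    EI≈E n = ≈-trans (Σ-cong (andreI N) inv≈invRec) (Σ-↭ (↭-map⁺ weight (andreI-↭ n)))
      where
      N = suc n
      inv≈invRec : ∀ {t} → t ∈ andreI N → pow R x (leaves t) * pow R y (oneChild t) * pow R q (inv N t) ≈ weight t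
      inv≈invRec {t} t∈ with andreTrees-sound N (range N) (range-sorted N) (∈-resp-↭ (andreI-↭ n) t∈)
      ... | t↭ , inc , _ = ≈-reflexive (≡.cong (λ e → pow R x (leaves t) * pow R y (oneChild t) * pow R q e) (inv≡invRec N t t↭ inc))

    E-rec : ∀ m → E (suc (suc m)) ≈ binomialSum q m (λ a b → rootFactor a * E a * E b)
    E-rec m = begin
      E (suc (suc m))                    ≈⟨ weightSum-range-rec (suc m) m ⟩
      binomialSum q m (ψ (suc m))        ≈⟨ binomialSum-cong q m {ψ (suc m)} {λ a b → rootFactor a * E a * E b}
                                              (λ {k} k≤m → *-cong (*-congˡ (refuel (m≤n⇒m≤1+n (m∸n≤m m k)))) (refuel (s≤s k≤m))) ⟩
      binomialSum q m (λ a b → rootFactor a * E a * E b) ∎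
      where
      refuel : ∀ {a} → a ≤ suc m → weightSum (suc m) (range a) ≈ E a
      refuel {a} a≤ = weightSum-fuel (suc m) a (range a) (range-sorted a)
        (≡.subst (_≤ suc m) (≡.sym (range-length a)) a≤) (≡.subst (_≤ a) (≡.sym (range-length a)) ≤-refl)

    EI-recurrence : ∀ m → EI R q x y (suc (suc m)) ≈
      y * EI R q x y (suc m) + Σ (map (λ k → pow R q (m ∸ k) * qbinom R q m k * EI R q x y (suc k) * EI R q x y (m ∸ k)) (upTo m))
    EI-recurrence m = begin
      EI R q x y (suc (suc m))                     ≈⟨ EI≈E (suc m) ⟩
      E (suc (suc m))                              ≈⟨ E-rec m ⟩
      binomialSum q m φ                            ≈⟨ Σ-upTo-∷ʳ m (λ k → qbinom R q m k * φ (m ∸ k) (suc k)) ⟩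
      Σ (map (λ k → qbinom R q m k * φ (m ∸ k) (suc k)) (upTo m)) + qbinom R q m m * φ (m ∸ m) (suc m)
        ≈⟨ +-cong (Σ-cong (upTo m) (inner ∘ ∈-upTo⁻)) last ⟩
      Σ (map summand (upTo m)) + y * EI R q x y (suc m)
        ≈⟨ +-comm _ _ ⟩
      y * EI R q x y (suc m) + Σ (map summand (upTo m)) ∎
      where
      φ = λ a b → rootFactor a * E a * E b
      summand = λ k → pow R q (m ∸ k) * qbinom R q m k * EI R q x y (suc k) * EI R q x y (m ∸ k)
      inner : ∀ {k} → k < m → qbinom R q m k * φ (m ∸ k) (suc k) ≈ summand k
      inner {k} k<m rewrite m∸n≡1+[m∸[1+n]] k<m = begin
        B * ((1# * Q) * E (suc j) * E (suc k))
          ≈⟨ *-congˡ (*-cong (*-cong (*-identityˡ Q) (≈-sym (EI≈E j))) (≈-sym (EI≈E k))) ⟩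
        B * (Q * EI R q x y (suc j) * EI R q x y (suc k))
          ≈⟨ solve 4 (λ B Q a b → B :* ((Q :* a) :* b) := ((Q :* B) :* b) :* a) ≈-refl B Q (EI R q x y (suc j)) (EI R q x y (suc k)) ⟩
        Q * B * EI R q x y (suc k) * EI R q x y (suc j) ∎
        where
        j = m ∸ suc k
        B = qbinom R q m k
        Q = pow R q (suc j)
      last : qbinom R q m m * φ (m ∸ m) (suc m) ≈ y * EI R q x y (suc m)
      last rewrite n∸n≡0 m = begin
        qbinom R q m m * (((y * 1#) * 1#) * E 0 * E (suc m))
          ≈⟨ *-cong (qbinom-diag q m) (*-congʳ (*-cong (≈-trans (*-identityʳ _) (*-identityʳ y)) E-zero)) ⟩
        1# * ((y * 1#) * E (suc m))
          ≈⟨ ≈-trans (*-identityˡ _) (*-congʳ (*-identityʳ y)) ⟩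
        y * E (suc m)
          ≈⟨ *-congˡ (≈-sym (EI≈E m)) ⟩
        y * EI R q x y (suc m) ∎

theorem6p8 : {c ℓ : Level} (R : CommutativeRing c ℓ) → let open CommutativeRing R in
    (q x y : Carrier) (n : ℕ) → 1 ≤ n →
    EI R q x y (suc n) ≈
      y * EI R q x y n
      + ΣR R (map (λ k → pow R q (n ∸ k ∸ 1) * qbinom R q (n ∸ 1) k * EI R q x y (suc k) * EI R q x y (n ∸ k ∸ 1))
                  (upTo (n ∸ 1)))
theorem6p8 R q x y (suc m) (s≤s z≤n) =
  trans (EI-recurrence q x y m) (+-congˡ (Σ-cong (upTo m) (λ {k} _ → reflexive
    (cong (λ e → pow R q e * qbinom R q m k * EI R q x y (suc k) * EI R q x y e) (sym (1+m∸k∸1≡m∸k k))))))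
  where
  open CommutativeRing R using (_*_; +-congˡ; trans; reflexive)
  open WeightSums R using (EI-recurrence; Σ-cong)
  open import Relation.Binary.PropositionalEquality as ≡ using (_≡_; cong; sym)
  open import Data.Nat.Properties using (∸-+-assoc; +-comm)
  1+m∸k∸1≡m∸k : ∀ k → suc m ∸ k ∸ 1 ≡ m ∸ k
  1+m∸k∸1≡m∸k k = ≡.trans (∸-+-assoc (suc m) k 1) (cong (suc m ∸_) (+-comm k 1))
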